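{- Let $d\ge2$. (1) Suppose $\mathrm{PG}_{d-1}(4)$ admits a legal truncation removing exactly $n_1$ points which leaves some hyperplane of $\mathrm{PG}_{d-1}(4)$ untouched, and also one removing exactly $n_2$ points which leaves some hyperplane untouched. Then $\mathrm{PG}_d(4)$ admits a legal truncation removing exactly $n_1+n_2$ points. (2) Suppose instead that $\mathrm{PG}_{d-1}(4)$ admits legal truncations removing exactly $n_1$, respectively $n_2$, points such that in each case the set of removed points meets some hyperplane in precisely a subspace isomorphic to $\mathrm{PG}_i(4)$. Then $\mathrm{PG}_d(4)$ admits a legal truncation removing exactly $n_1+n_2-[i]_4$ points.
   Context: $\mathrm{PG}_d(4)$ is the projective space of dimension $d$ over $\mathbb{F}_4$: its points are the 1-dimensional subspaces of $\mathbb{F}_4^{d+1}$ and its lines are the 2-dimensional subspaces (each line has 5 points); hyperplanes are the $d$-dimensional subspaces (copies of $\mathrm{PG}_{d-1}(4)$), and a copy of $\mathrm{PG}_i(4)$ is the set of points of an $(i+1)$-dimensional subspace. $[i]_4=1+4+\cdots+4^i$. A truncation of $\mathrm{PG}_d(4)$ is the removal of a set of points; it is legal if no line of $\mathrm{PG}_d(4)$ retains exactly two points. -}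

module Defs where

open import Data.Nat using (ℕ; zero; suc; _+_; _*_)
open import Data.Bool using (Bool; true; false; _∧_; T)
open import Data.List using (List; []; _∷_; map; concatMap)
open import Data.Vec using (Vec; []; _∷_; zipWith; replicate)
open import Data.Fin using (Fin; zero; suc)
open import Data.Product using (Σ; ∃; _×_; proj₁)
open import Data.Sum using (_⊎_)
open import Data.Empty using (⊥)
open import Relation.Binary.PropositionalEquality using (_≡_; _≢_)

-- The field F_4 = {0, 1, ω, ω²} with ω² = ω + 1.
data F4 : Set where
  𝟘 𝟙 ω ω² : F4

_+F_ : F4 → F4 → F4
𝟘 +F y = y
x +F 𝟘 = x
𝟙 +F 𝟙 = 𝟘
𝟙 +F ω = ω²
𝟙 +F ω² = ω
ω +F 𝟙 = ω²
ω +F ω = 𝟘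
ω +F ω² = 𝟙
ω² +F 𝟙 = ω
ω² +F ω = 𝟙
ω² +F ω² = 𝟘

_*F_ : F4 → F4 → F4
𝟘 *F _ = 𝟘
_ *F 𝟘 = 𝟘
𝟙 *F y = y
x *F 𝟙 = x
ω *F ω = ω²
ω *F ω² = 𝟙
ω² *F ω = 𝟙
ω² *F ω² = ω

elemsF4 : List F4
elemsF4 = 𝟘 ∷ 𝟙 ∷ ω ∷ ω² ∷ []

_+V_ : ∀ {m} → Vec F4 m → Vec F4 m → Vec F4 m
_+V_ = zipWith _+F_

_·V_ : ∀ {m} → F4 → Vec F4 m → Vec F4 m
a ·V [] = []
a ·V (x ∷ v) = (a *F x) ∷ (a ·V v)

zeroV : ∀ {m} → Vec F4 m
zeroV = replicate _ 𝟘

lincomb : ∀ {k m} → (Fin k → F4) → (Fin k → Vec F4 m) → Vec F4 m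
lincomb {zero}  c v = zeroV
lincomb {suc k} c v = (c zero ·V v zero) +V lincomb (λ j → c (suc j)) (λ j → v (suc j))

Independent : ∀ {k m} → (Fin k → Vec F4 m) → Set
Independent {k} v = ∀ (c : Fin k → F4) → lincomb c v ≡ zeroV → ∀ j → c j ≡ 𝟘

InSpan : ∀ {k m} → (Fin k → Vec F4 m) → Vec F4 m → Set
InSpan {k} v x = Σ (Fin k → F4) (λ c → lincomb c v ≡ x)

allVecs : ∀ m → List (Vec F4 m)
allVecs zero = [] ∷ []
allVecs (suc m) = concatMap (λ x → map (x ∷_) (allVecs m)) elemsF4

-- Points of PG(m-1,4) = 1-dim subspaces of F_4^m, represented by their unique
-- normalised representative (first nonzero coordinate equal to 1).
isNorm : ∀ {m} → Vec F4 m → Bool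
isNorm [] = false
isNorm (𝟘 ∷ v) = isNorm v
isNorm (𝟙 ∷ v) = true
isNorm (ω ∷ v) = false
isNorm (ω² ∷ v) = false

Pt : ℕ → Set
Pt m = Σ (Vec F4 m) (λ v → T (isNorm v))

-- A set of removed points of PG(m-1,4): a Boolean predicate (only its values
-- on normalised vectors matter).
PtSet : ℕ → Set
PtSet m = Vec F4 m → Bool

countB : ∀ {A : Set} → (A → Bool) → List A → ℕ
countB p [] = zero
countB p (x ∷ xs) with p x
... | true = suc (countB p xs)
... | false = countB p xs

numPts : ∀ {m} → PtSet m → ℕ
numPts {m} R = countB (λ v → isNorm v ∧ R v) (allVecs m)

OnLine : ∀ {m} → Pt m → Pt m → Pt m → Set
OnLine p q r = Σ F4 (λ a → Σ F4 (λ b → proj₁ r ≡ (a ·V proj₁ p) +V (b ·V proj₁ q)))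

Retained : ∀ {m} → PtSet m → Pt m → Set
Retained R x = R (proj₁ x) ≡ false

RetainsExactlyTwo : ∀ {m} → PtSet m → Pt m → Pt m → Set
RetainsExactlyTwo {m} R p q =
  Σ (Pt m) λ x → Σ (Pt m) λ y →
    OnLine p q x × OnLine p q y × Retained R x × Retained R y ×
    (proj₁ x ≢ proj₁ y) ×
    (∀ (z : Pt m) → OnLine p q z → Retained R z →
       (proj₁ z ≡ proj₁ x) ⊎ (proj₁ z ≡ proj₁ y))

Legal : ∀ {m} → PtSet m → Set
Legal {m} R = ∀ (p q : Pt m) → proj₁ p ≢ proj₁ q → RetainsExactlyTwo R p q → ⊥

-- A copy of PG_i(4) inside PG(m-1,4): spanned by i+1 independent vectors.
-- Hyperplane of PG(m-1,4): spanned by m-1 independent vectors (h : Fin k → Vec F4 (suc k)).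

Untouched : ∀ {k} → PtSet (suc k) → (Fin k → Vec F4 (suc k)) → Set
Untouched {k} R h = ∀ (p : Pt (suc k)) → InSpan h (proj₁ p) → R (proj₁ p) ≡ false

MeetsExactly : ∀ {k i} → PtSet (suc k) → (Fin k → Vec F4 (suc k)) → (Fin (suc i) → Vec F4 (suc k)) → Set
MeetsExactly {k} R h w = ∀ (p : Pt (suc k)) →
  ((R (proj₁ p) ≡ true × InSpan h (proj₁ p)) → InSpan w (proj₁ p)) ×
  (InSpan w (proj₁ p) → (R (proj₁ p) ≡ true × InSpan h (proj₁ p)))

-- [i]_4 = 1 + 4 + ... + 4^i
qnum : ℕ → ℕ
qnum zero = 1
qnum (suc i) = 1 + 4 * qnum i

module Submission where

open import Defs
open import Data.Nat using (ℕ; zero; suc; _+_; _*_; _∸_; _^_; _≤_; _<_; z≤n; s≤s)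
open import Data.Nat.Properties
  using (_≟_; _<?_; ≤-refl; ≤-trans; ≤-pred; <-irrefl; ≤-<-trans; ≮⇒≥; ≤∧≢⇒<; n≤1+n; m≤n+m;
         m<n⇒m<1+n; m≤n⇒m<n∨m≡n; +-suc; +-identityʳ; ∸-monoʳ-<; m+n≤o⇒m≤o∸n; m≤o∸n⇒m+n≤o;
         m∸n+n≡m; m+n∸n≡m; *-cancelˡ-≡)
open import Data.Nat.Solver using (module +-*-Solver)
open import Data.Bool using (Bool; true; false; _∧_; T; if_then_else_)
open import Data.Bool.Properties using (∧-zeroʳ)
open import Data.Unit using (⊤; tt)
open import Data.List using ([]; _∷_; map; _++_)
open import Data.Vec using (Vec; []; _∷_; head; tail)
open import Data.Fin using (Fin; zero; suc)
open import Data.Product using (Σ; _×_; _,_; proj₁; proj₂)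
open import Data.Sum using (_⊎_; inj₁; inj₂; [_,_]′)
open import Data.Empty using (⊥; ⊥-elim)
open import Relation.Nullary using (Dec; yes; no)
open import Relation.Nullary.Decidable using (⌊_⌋; toWitness)
open import Relation.Binary.PropositionalEquality
open +-*-Solver using (solve; _:=_; _:+_; _:*_; con)

-- Let R₁, R₂ be legal truncations of PG(k,4) (coordinates F4^(k+1))
-- that agree on the hyperplane x₀ = 0.  Put R₁ on the hyperplane X₀ = 0 of
-- PG(k+1,4) and R₂ on X₁ = 0 (these meet in the common part).  A line retaining
-- exactly two points x, y has its three other points x + c y (c ≠ 0) removed, so
-- each lies on X₀ = 0 or X₁ = 0; by pigeonhole two of them lie on the same
-- hyperplane, so the whole line does, contradicting the legality of R₁ or R₂.
-- Counting by inclusion–exclusion, the glued set has |R₁| + |R₂| - |common| points.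
--
-- The hypotheses give an arbitrary hyperplane H = span h (and,
-- for part (2), a subspace W = span w with R ∩ H = W).  Gaussian elimination gives
-- a linear automorphism moving H to x₀ = 0 (and W to a coordinate subspace), and
-- automorphisms preserve legality and point counts.  In part (1) the common part
-- is empty; in part (2) it is a standard PG(i,4), with [i]₄ points.

_≟F_ : (a b : F4) → Dec (a ≡ b)
𝟘 ≟F 𝟘 = yes refl
𝟙 ≟F 𝟙 = yes refl
ω ≟F ω = yes refl
ω² ≟F ω² = yes refl
𝟘 ≟F 𝟙 = no λ ()
𝟘 ≟F ω = no λ ()
𝟘 ≟F ω² = no λ ()
𝟙 ≟F 𝟘 = no λ ()
𝟙 ≟F ω = no λ ()
𝟙 ≟F ω² = no λ ()
ω ≟F 𝟘 = no λ ()
ω ≟F 𝟙 = no λ ()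
ω ≟F ω² = no λ ()
ω² ≟F 𝟘 = no λ ()
ω² ≟F 𝟙 = no λ ()
ω² ≟F ω = no λ ()

-- A Boolean test holds for every element of F4 iff it holds for the four
-- elements; this turns identities of the finite field into computations.
all4 : (F4 → Bool) → Bool
all4 p = p 𝟘 ∧ (p 𝟙 ∧ (p ω ∧ p ω²))

∧-l : ∀ {x y} → T (x ∧ y) → T x
∧-l {true} _ = tt

∧-r : ∀ {x y} → T (x ∧ y) → T y
∧-r {true} h = h

all4-sound : ∀ p → T (all4 p) → ∀ a → T (p a)
all4-sound p h 𝟘 = ∧-l {p 𝟘} h
all4-sound p h 𝟙 = ∧-l {p 𝟙} (∧-r {p 𝟘} h)
all4-sound p h ω = ∧-l {p ω} (∧-r {p 𝟙} (∧-r {p 𝟘} h))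
all4-sound p h ω² = ∧-r {p ω} (∧-r {p 𝟙} (∧-r {p 𝟘} h))

law₁ : (l r : F4 → F4) → T (all4 λ a → ⌊ l a ≟F r a ⌋) → ∀ a → l a ≡ r a
law₁ l r h a = toWitness (all4-sound (λ a → ⌊ l a ≟F r a ⌋) h a)

law₂ : (l r : F4 → F4 → F4) → T (all4 λ a → all4 λ b → ⌊ l a b ≟F r a b ⌋) →
       ∀ a b → l a b ≡ r a b
law₂ l r h a b = toWitness (all4-sound (λ b → ⌊ l a b ≟F r a b ⌋)
  (all4-sound (λ a → all4 λ b → ⌊ l a b ≟F r a b ⌋) h a) b)

law₃ : (l r : F4 → F4 → F4 → F4) →
       T (all4 λ a → all4 λ b → all4 λ c → ⌊ l a b c ≟F r a b c ⌋) →
       ∀ a b c → l a b c ≡ r a b c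
law₃ l r h a b c = toWitness (all4-sound (λ c → ⌊ l a b c ≟F r a b c ⌋)
  (all4-sound (λ b → all4 λ c → ⌊ l a b c ≟F r a b c ⌋)
    (all4-sound (λ a → all4 λ b → all4 λ c → ⌊ l a b c ≟F r a b c ⌋) h a) b) c)

+F-comm : ∀ a b → a +F b ≡ b +F a
+F-comm = law₂ (λ a b → a +F b) (λ a b → b +F a) _

+F-assoc : ∀ a b c → (a +F b) +F c ≡ a +F (b +F c)
+F-assoc = law₃ (λ a b c → (a +F b) +F c) (λ a b c → a +F (b +F c)) _

+F-idʳ : ∀ a → a +F 𝟘 ≡ a
+F-idʳ = law₁ (λ a → a +F 𝟘) (λ a → a) _

+F-self : ∀ a → a +F a ≡ 𝟘
+F-self = law₁ (λ a → a +F a) (λ _ → 𝟘) _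

*F-comm : ∀ a b → a *F b ≡ b *F a
*F-comm = law₂ (λ a b → a *F b) (λ a b → b *F a) _

*F-assoc : ∀ a b c → (a *F b) *F c ≡ a *F (b *F c)
*F-assoc = law₃ (λ a b c → (a *F b) *F c) (λ a b c → a *F (b *F c)) _

*F-zeroʳ : ∀ a → a *F 𝟘 ≡ 𝟘
*F-zeroʳ = law₁ (λ a → a *F 𝟘) (λ _ → 𝟘) _

*F-oneˡ : ∀ a → 𝟙 *F a ≡ a
*F-oneˡ = law₁ (λ a → 𝟙 *F a) (λ a → a) _

*F-oneʳ : ∀ a → a *F 𝟙 ≡ a
*F-oneʳ = law₁ (λ a → a *F 𝟙) (λ a → a) _

*F-distˡ : ∀ a b c → a *F (b +F c) ≡ (a *F b) +F (a *F c)
*F-distˡ = law₃ (λ a b c → a *F (b +F c)) (λ a b c → (a *F b) +F (a *F c)) _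

*F-distʳ : ∀ a b c → (a +F b) *F c ≡ (a *F c) +F (b *F c)
*F-distʳ = law₃ (λ a b c → (a +F b) *F c) (λ a b c → (a *F c) +F (b *F c)) _

𝟙≢𝟘 : 𝟙 ≢ 𝟘
𝟙≢𝟘 ()

-- Multiplicative inverses (with the convention inv 𝟘 = 𝟘).
inv : F4 → F4
inv 𝟘 = 𝟘
inv 𝟙 = 𝟙
inv ω = ω²
inv ω² = ω

inv-inv : ∀ a → inv (inv a) ≡ a
inv-inv = law₁ (λ a → inv (inv a)) (λ a → a) _

inv-* : ∀ a b → inv (a *F b) ≡ inv a *F inv b
inv-* = law₂ (λ a b → inv (a *F b)) (λ a b → inv a *F inv b) _

inv-l : ∀ a → a ≢ 𝟘 → inv a *F a ≡ 𝟙
inv-l 𝟘 nz = ⊥-elim (nz refl)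
inv-l 𝟙 nz = refl
inv-l ω nz = refl
inv-l ω² nz = refl

inv-nz : ∀ a → a ≢ 𝟘 → inv a ≢ 𝟘
inv-nz 𝟘 nz = ⊥-elim (nz refl)
inv-nz 𝟙 nz ()
inv-nz ω nz ()
inv-nz ω² nz ()

-- inv (c l) · c = inv l for c ≠ 0: rescaling does not change normal forms.
inv-cancel : ∀ c l → c ≢ 𝟘 → inv (c *F l) *F c ≡ inv l
inv-cancel c l nz = begin
  inv (c *F l) *F c       ≡⟨ cong (_*F c) (trans (inv-* c l) (*F-comm (inv c) (inv l))) ⟩
  (inv l *F inv c) *F c   ≡⟨ *F-assoc (inv l) (inv c) c ⟩
  inv l *F (inv c *F c)   ≡⟨ cong (inv l *F_) (inv-l c nz) ⟩
  inv l *F 𝟙              ≡⟨ *F-oneʳ (inv l) ⟩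
  inv l                   ∎
  where open ≡-Reasoning

mul-zero : ∀ a b → a *F b ≡ 𝟘 → a ≡ 𝟘 ⊎ b ≡ 𝟘
mul-zero a b ab0 with a ≟F 𝟘
... | yes a0 = inj₁ a0
... | no a≢0 = inj₂ (begin
  b                   ≡⟨ sym (*F-oneˡ b) ⟩
  𝟙 *F b              ≡⟨ cong (_*F b) (sym (inv-l a a≢0)) ⟩
  (inv a *F a) *F b   ≡⟨ *F-assoc (inv a) a b ⟩
  inv a *F (a *F b)   ≡⟨ cong (inv a *F_) ab0 ⟩
  inv a *F 𝟘          ≡⟨ *F-zeroʳ (inv a) ⟩
  𝟘                   ∎)
  where open ≡-Reasoning

mul-nz : ∀ a b → a ≢ 𝟘 → b ≢ 𝟘 → a *F b ≢ 𝟘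
mul-nz a b a≢0 b≢0 ab0 with mul-zero a b ab0
... | inj₁ a0 = a≢0 a0
... | inj₂ b0 = b≢0 b0

sum0 : ∀ a b → a +F b ≡ 𝟘 → a ≡ b
sum0 a b ab0 = begin
  a               ≡⟨ sym (+F-idʳ a) ⟩
  a +F 𝟘          ≡⟨ cong (a +F_) (sym (+F-self b)) ⟩
  a +F (b +F b)   ≡⟨ sym (+F-assoc a b b) ⟩
  (a +F b) +F b   ≡⟨ cong (_+F b) ab0 ⟩
  b               ∎
  where open ≡-Reasoning

V : ℕ → Set
V m = Vec F4 m

+V-comm : ∀ {m} (x y : V m) → x +V y ≡ y +V x
+V-comm [] [] = refl
+V-comm (a ∷ x) (b ∷ y) = cong₂ _∷_ (+F-comm a b) (+V-comm x y)

+V-assoc : ∀ {m} (x y z : V m) → (x +V y) +V z ≡ x +V (y +V z)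
+V-assoc [] [] [] = refl
+V-assoc (a ∷ x) (b ∷ y) (c ∷ z) = cong₂ _∷_ (+F-assoc a b c) (+V-assoc x y z)

+V-idʳ : ∀ {m} (x : V m) → x +V zeroV ≡ x
+V-idʳ [] = refl
+V-idʳ (a ∷ x) = cong₂ _∷_ (+F-idʳ a) (+V-idʳ x)

+V-idˡ : ∀ {m} (x : V m) → zeroV +V x ≡ x
+V-idˡ [] = refl
+V-idˡ (a ∷ x) = cong (a ∷_) (+V-idˡ x)

+V-self : ∀ {m} (x : V m) → x +V x ≡ zeroV
+V-self [] = refl
+V-self (a ∷ x) = cong₂ _∷_ (+F-self a) (+V-self x)

·V-distˡ : ∀ {m} a (x y : V m) → a ·V (x +V y) ≡ (a ·V x) +V (a ·V y)
·V-distˡ a [] [] = refl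
·V-distˡ a (b ∷ x) (c ∷ y) = cong₂ _∷_ (*F-distˡ a b c) (·V-distˡ a x y)

·V-distʳ : ∀ {m} a b (x : V m) → (a +F b) ·V x ≡ (a ·V x) +V (b ·V x)
·V-distʳ a b [] = refl
·V-distʳ a b (c ∷ x) = cong₂ _∷_ (*F-distʳ a b c) (·V-distʳ a b x)

·V-assoc : ∀ {m} a b (x : V m) → a ·V (b ·V x) ≡ (a *F b) ·V x
·V-assoc a b [] = refl
·V-assoc a b (c ∷ x) = cong₂ _∷_ (sym (*F-assoc a b c)) (·V-assoc a b x)

·V-one : ∀ {m} (x : V m) → 𝟙 ·V x ≡ x
·V-one [] = refl
·V-one (c ∷ x) = cong₂ _∷_ (*F-oneˡ c) (·V-one x)

·V-zero : ∀ {m} (x : V m) → 𝟘 ·V x ≡ zeroV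
·V-zero [] = refl
·V-zero (c ∷ x) = cong (𝟘 ∷_) (·V-zero x)

·V-zeroV : ∀ {m} a → a ·V zeroV {m} ≡ zeroV
·V-zeroV {zero} a = refl
·V-zeroV {suc m} a = cong₂ _∷_ (*F-zeroʳ a) (·V-zeroV {m} a)

sum0V : ∀ {m} (x y : V m) → x +V y ≡ zeroV → x ≡ y
sum0V x y xy0 = begin
  x               ≡⟨ sym (+V-idʳ x) ⟩
  x +V zeroV      ≡⟨ cong (x +V_) (sym (+V-self y)) ⟩
  x +V (y +V y)   ≡⟨ sym (+V-assoc x y y) ⟩
  (x +V y) +V y   ≡⟨ cong (_+V y) xy0 ⟩
  zeroV +V y      ≡⟨ +V-idˡ y ⟩
  y               ∎
  where open ≡-Reasoning

+V-inter : ∀ {m} (x y z w : V m) → (x +V y) +V (z +V w) ≡ (x +V z) +V (y +V w)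
+V-inter x y z w = begin
  (x +V y) +V (z +V w)   ≡⟨ +V-assoc x y (z +V w) ⟩
  x +V (y +V (z +V w))   ≡⟨ cong (x +V_) (sym (+V-assoc y z w)) ⟩
  x +V ((y +V z) +V w)   ≡⟨ cong (λ t → x +V (t +V w)) (+V-comm y z) ⟩
  x +V ((z +V y) +V w)   ≡⟨ cong (x +V_) (+V-assoc z y w) ⟩
  x +V (z +V (y +V w))   ≡⟨ sym (+V-assoc x z (y +V w)) ⟩
  (x +V z) +V (y +V w)   ∎
  where open ≡-Reasoning

-- The p-th coordinate of a vector (𝟘 beyond its length).
coord : ∀ {m} → V m → ℕ → F4
coord [] p = 𝟘
coord (a ∷ x) zero = a
coord (a ∷ x) (suc p) = coord x p

coord-+V : ∀ {m} (x y : V m) p → coord (x +V y) p ≡ coord x p +F coord y p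
coord-+V [] [] p = refl
coord-+V (a ∷ x) (b ∷ y) zero = refl
coord-+V (a ∷ x) (b ∷ y) (suc p) = coord-+V x y p

coord-·V : ∀ {m} c (x : V m) p → coord (c ·V x) p ≡ c *F coord x p
coord-·V c [] p = sym (*F-zeroʳ c)
coord-·V c (a ∷ x) zero = refl
coord-·V c (a ∷ x) (suc p) = coord-·V c x p

coord-zeroV : ∀ {m} p → coord (zeroV {m}) p ≡ 𝟘
coord-zeroV {zero} p = refl
coord-zeroV {suc m} zero = refl
coord-zeroV {suc m} (suc p) = coord-zeroV {m} p

coord-ext : ∀ {m} (x y : V m) → (∀ p → coord x p ≡ coord y p) → x ≡ y
coord-ext [] [] h = refl
coord-ext (a ∷ x) (b ∷ y) h = cong₂ _∷_ (h zero) (coord-ext x y (λ p → h (suc p)))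

coord-out : ∀ {m} (x : V m) p → m ≤ p → coord x p ≡ 𝟘
coord-out [] p le = refl
coord-out (a ∷ x) (suc p) (s≤s le) = coord-out x p le

-- The unit vector e q (the zero vector if q is out of range).
e : ∀ {m} → ℕ → V m
e {zero} q = []
e {suc m} zero = 𝟙 ∷ zeroV
e {suc m} (suc q) = 𝟘 ∷ e {m} q

coord-e-same : ∀ {m} q → q < m → coord (e {m} q) q ≡ 𝟙
coord-e-same {suc m} zero lt = refl
coord-e-same {suc m} (suc q) (s≤s lt) = coord-e-same {m} q lt

coord-e-diff : ∀ {m} q p → p ≢ q → coord (e {m} q) p ≡ 𝟘
coord-e-diff {zero} q p ne = refl
coord-e-diff {suc m} zero zero ne = ⊥-elim (ne refl)
coord-e-diff {suc m} zero (suc p) ne = coord-zeroV {m} p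
coord-e-diff {suc m} (suc q) zero ne = refl
coord-e-diff {suc m} (suc q) (suc p) ne = coord-e-diff {m} q p (λ eq → ne (cong suc eq))

F4sum : (F4 → ℕ) → ℕ
F4sum H = H 𝟘 + (H 𝟙 + (H ω + H ω²))

S : (m : ℕ) → (V m → ℕ) → ℕ
S zero F = F []
S (suc m) F = F4sum (λ a → S m (λ x → F (a ∷ x)))

F4sum-cong : ∀ {H K : F4 → ℕ} → (∀ a → H a ≡ K a) → F4sum H ≡ F4sum K
F4sum-cong h = cong₂ _+_ (h 𝟘) (cong₂ _+_ (h 𝟙) (cong₂ _+_ (h ω) (h ω²)))

S-cong : ∀ m {F G : V m → ℕ} → (∀ x → F x ≡ G x) → S m F ≡ S m G
S-cong zero h = h []
S-cong (suc m) h = F4sum-cong (λ a → S-cong m (λ x → h (a ∷ x)))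

F4sum-add : ∀ (H K : F4 → ℕ) → F4sum (λ a → H a + K a) ≡ F4sum H + F4sum K
F4sum-add H K =
  solve 8 (λ a b c d a' b' c' d' → (a :+ a') :+ ((b :+ b') :+ ((c :+ c') :+ (d :+ d')))
                                 := (a :+ (b :+ (c :+ d))) :+ (a' :+ (b' :+ (c' :+ d')))) refl
    (H 𝟘) (H 𝟙) (H ω) (H ω²) (K 𝟘) (K 𝟙) (K ω) (K ω²)

S-add : ∀ m (F G : V m → ℕ) → S m (λ x → F x + G x) ≡ S m F + S m G
S-add zero F G = refl
S-add (suc m) F G = trans (F4sum-cong (λ a → S-add m (λ x → F (a ∷ x)) (λ x → G (a ∷ x))))
                          (F4sum-add (λ a → S m (λ x → F (a ∷ x))) (λ a → S m (λ x → G (a ∷ x))))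

S-zero : ∀ m → S m (λ _ → 0) ≡ 0
S-zero zero = refl
S-zero (suc m) rewrite S-zero m = refl

S-one : ∀ m → S m (λ _ → 1) ≡ 4 ^ m
S-one zero = refl
S-one (suc m) rewrite S-one m = solve 1 (λ x → x :+ (x :+ (x :+ x)) := con 4 :* x) refl (4 ^ m)

F4sum-trans : ∀ (H : F4 → ℕ) b → F4sum (λ a → H (a +F b)) ≡ F4sum H
F4sum-trans H 𝟘 = refl
F4sum-trans H 𝟙 = solve 4 (λ a b c d → b :+ (a :+ (d :+ c)) := a :+ (b :+ (c :+ d))) refl (H 𝟘) (H 𝟙) (H ω) (H ω²)
F4sum-trans H ω = solve 4 (λ a b c d → c :+ (d :+ (a :+ b)) := a :+ (b :+ (c :+ d))) refl (H 𝟘) (H 𝟙) (H ω) (H ω²)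
F4sum-trans H ω² = solve 4 (λ a b c d → d :+ (c :+ (b :+ a)) := a :+ (b :+ (c :+ d))) refl (H 𝟘) (H 𝟙) (H ω) (H ω²)

F4sum-scale : ∀ (H : F4 → ℕ) c → c ≢ 𝟘 → F4sum (λ a → H (c *F a)) ≡ F4sum H
F4sum-scale H 𝟘 nz = ⊥-elim (nz refl)
F4sum-scale H 𝟙 nz = refl
F4sum-scale H ω nz = solve 4 (λ a b c d → a :+ (c :+ (d :+ b)) := a :+ (b :+ (c :+ d))) refl (H 𝟘) (H 𝟙) (H ω) (H ω²)
F4sum-scale H ω² nz = solve 4 (λ a b c d → a :+ (d :+ (b :+ c)) := a :+ (b :+ (c :+ d))) refl (H 𝟘) (H 𝟙) (H ω) (H ω²)

S-trans : ∀ m (F : V m → ℕ) (w : V m) → S m (λ x → F (x +V w)) ≡ S m F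
S-trans zero F [] = refl
S-trans (suc m) F (b ∷ w) =
  trans (F4sum-cong (λ a → S-trans m (λ x → F ((a +F b) ∷ x)) w))
        (F4sum-trans (λ a → S m (λ x → F (a ∷ x))) b)

S-scale : ∀ m (F : V m → ℕ) c → c ≢ 𝟘 → S m (λ x → F (c ·V x)) ≡ S m F
S-scale zero F c nz = refl
S-scale (suc m) F c nz =
  trans (F4sum-cong (λ a → S-scale m (λ x → F ((c *F a) ∷ x)) c nz))
        (F4sum-scale (λ a → S m (λ x → F (a ∷ x))) c nz)

fubini : ∀ m (H : F4 → V m → ℕ) → S m (λ x → F4sum (λ a → H a x)) ≡ F4sum (λ a → S m (H a))
fubini m H = begin
  S m (λ x → H 𝟘 x + (H 𝟙 x + (H ω x + H ω² x)))
    ≡⟨ S-add m (H 𝟘) _ ⟩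
  S m (H 𝟘) + S m (λ x → H 𝟙 x + (H ω x + H ω² x))
    ≡⟨ cong (S m (H 𝟘) +_) (S-add m (H 𝟙) _) ⟩
  S m (H 𝟘) + (S m (H 𝟙) + S m (λ x → H ω x + H ω² x))
    ≡⟨ cong (λ t → S m (H 𝟘) + (S m (H 𝟙) + t)) (S-add m (H ω) (H ω²)) ⟩
  F4sum (λ a → S m (H a)) ∎
  where open ≡-Reasoning

-- The shear x ↦ x + x_p v (with v_p = 0) permutes F4^m, so sums are invariant under it.
S-shear : ∀ m (F : V m → ℕ) p (v : V m) → coord v p ≡ 𝟘 →
          S m (λ x → F (x +V (coord x p ·V v))) ≡ S m F
S-shear zero F p [] h = refl
S-shear (suc m) F zero (v0 ∷ v) refl = begin
  F4sum (λ a → S m (λ x → F ((a +F (a *F 𝟘)) ∷ (x +V (a ·V v)))))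
    ≡⟨ F4sum-cong (λ a → cong (λ t → S m (λ x → F (t ∷ (x +V (a ·V v)))))
                              (trans (cong (a +F_) (*F-zeroʳ a)) (+F-idʳ a))) ⟩
  F4sum (λ a → S m (λ x → F (a ∷ (x +V (a ·V v)))))
    ≡⟨ F4sum-cong (λ a → S-trans m (λ x → F (a ∷ x)) (a ·V v)) ⟩
  S (suc m) F ∎
  where open ≡-Reasoning
S-shear (suc m) F (suc p) (v0 ∷ v) h = begin
  F4sum (λ a → S m (λ x → F ((a +F (coord x p *F v0)) ∷ (x +V (coord x p ·V v)))))
    ≡⟨ sym (fubini m (λ a x → F ((a +F (coord x p *F v0)) ∷ (x +V (coord x p ·V v))))) ⟩
  S m (λ x → F4sum (λ a → F ((a +F (coord x p *F v0)) ∷ (x +V (coord x p ·V v)))))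
    ≡⟨ S-cong m (λ x → F4sum-trans (λ a → F (a ∷ (x +V (coord x p ·V v)))) (coord x p *F v0)) ⟩
  S m (λ x → F4sum (λ a → F (a ∷ (x +V (coord x p ·V v)))))
    ≡⟨ fubini m (λ a x → F (a ∷ (x +V (coord x p ·V v)))) ⟩
  F4sum (λ a → S m (λ x → F (a ∷ (x +V (coord x p ·V v)))))
    ≡⟨ F4sum-cong (λ a → S-shear m (λ x → F (a ∷ x)) p v h) ⟩
  S (suc m) F ∎
  where open ≡-Reasoning

scaleAt : ∀ {m} → ℕ → F4 → V m → V m
scaleAt p c [] = []
scaleAt zero c (a ∷ x) = (c *F a) ∷ x
scaleAt (suc p) c (a ∷ x) = a ∷ scaleAt p c x

S-scaleAt : ∀ m (F : V m → ℕ) p c → c ≢ 𝟘 → S m (λ x → F (scaleAt p c x)) ≡ S m F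
S-scaleAt zero F p c nz = refl
S-scaleAt (suc m) F zero c nz = F4sum-scale (λ a → S m (λ x → F (a ∷ x))) c nz
S-scaleAt (suc m) F (suc p) c nz = F4sum-cong (λ a → S-scaleAt m (λ x → F (a ∷ x)) p c nz)

∧-cong-T : ∀ (a : Bool) {b c : Bool} → (T a → b ≡ c) → a ∧ b ≡ a ∧ c
∧-cong-T true b≡c = b≡c tt
∧-cong-T false b≡c = refl

true-together : ∀ {a b : Bool} → (a ≡ true → b ≡ true) → (b ≡ true → a ≡ true) → a ≡ b
true-together {true} {true} _ _ = refl
true-together {false} {false} _ _ = refl
true-together {true} {false} ab _ = sym (ab refl)
true-together {false} {true} _ ba = ba refl

b2n : Bool → ℕ
b2n true = 1
b2n false = 0

countB-++ : ∀ {A : Set} (p : A → Bool) xs ys → countB p (xs ++ ys) ≡ countB p xs + countB p ys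
countB-++ p [] ys = refl
countB-++ p (x ∷ xs) ys with p x
... | true = cong suc (countB-++ p xs ys)
... | false = countB-++ p xs ys

countB-map : ∀ {A B : Set} (p : B → Bool) (f : A → B) xs →
             countB p (map f xs) ≡ countB (λ x → p (f x)) xs
countB-map p f [] = refl
countB-map p f (x ∷ xs) with p (f x)
... | true = cong suc (countB-map p f xs)
... | false = countB-map p f xs

countS : ∀ m (p : V m → Bool) → countB p (allVecs m) ≡ S m (λ v → b2n (p v))
countS zero p with p []
... | true = refl
... | false = refl
countS (suc m) p = begin
  countB p (map (𝟘 ∷_) L ++ (map (𝟙 ∷_) L ++ (map (ω ∷_) L ++ (map (ω² ∷_) L ++ []))))
    ≡⟨ countB-++ p (map (𝟘 ∷_) L) _ ⟩
  c 𝟘 + countB p (map (𝟙 ∷_) L ++ (map (ω ∷_) L ++ (map (ω² ∷_) L ++ [])))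
    ≡⟨ cong (c 𝟘 +_) (countB-++ p (map (𝟙 ∷_) L) _) ⟩
  c 𝟘 + (c 𝟙 + countB p (map (ω ∷_) L ++ (map (ω² ∷_) L ++ [])))
    ≡⟨ cong (λ t → c 𝟘 + (c 𝟙 + t)) (countB-++ p (map (ω ∷_) L) _) ⟩
  c 𝟘 + (c 𝟙 + (c ω + countB p (map (ω² ∷_) L ++ [])))
    ≡⟨ cong (λ t → c 𝟘 + (c 𝟙 + (c ω + t))) (trans (countB-++ p (map (ω² ∷_) L) []) (+-identityʳ _)) ⟩
  F4sum c
    ≡⟨ F4sum-cong (λ a → trans (countB-map p (a ∷_) L) (countS m (λ x → p (a ∷ x)))) ⟩
  S (suc m) (λ v → b2n (p v)) ∎
  where
  open ≡-Reasoning
  L = allVecs m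
  c : F4 → ℕ
  c a = countB p (map (a ∷_) L)

lincomb-cong : ∀ {k m} (c : Fin k → F4) (v w : Fin k → V m) → (∀ t → v t ≡ w t) →
               lincomb c v ≡ lincomb c w
lincomb-cong {zero} c v w h = refl
lincomb-cong {suc k} c v w h = cong₂ _+V_ (cong (c zero ·V_) (h zero))
  (lincomb-cong (λ j → c (suc j)) (λ j → v (suc j)) (λ j → w (suc j)) (λ t → h (suc t)))

lincomb-ccong : ∀ {k m} (c d : Fin k → F4) (v : Fin k → V m) → (∀ t → c t ≡ d t) →
                lincomb c v ≡ lincomb d v
lincomb-ccong {zero} c d v h = refl
lincomb-ccong {suc k} c d v h = cong₂ _+V_ (cong (_·V v zero) (h zero))
  (lincomb-ccong (λ j → c (suc j)) (λ j → d (suc j)) (λ j → v (suc j)) (λ t → h (suc t)))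

lincomb-scale : ∀ {k m} a (c : Fin k → F4) (v : Fin k → V m) →
                lincomb (λ t → a *F c t) v ≡ a ·V lincomb c v
lincomb-scale {zero} a c v = sym (·V-zeroV a)
lincomb-scale {suc k} a c v = begin
  ((a *F c zero) ·V v zero) +V lincomb (λ t → a *F c (suc t)) (λ t → v (suc t))
    ≡⟨ cong₂ _+V_ (sym (·V-assoc a (c zero) (v zero))) (lincomb-scale a (λ t → c (suc t)) (λ t → v (suc t))) ⟩
  (a ·V (c zero ·V v zero)) +V (a ·V lincomb (λ t → c (suc t)) (λ t → v (suc t)))
    ≡⟨ sym (·V-distˡ a _ _) ⟩
  a ·V lincomb c v ∎
  where open ≡-Reasoning

lincomb-zeros : ∀ {k m} (c : Fin k → F4) (v : Fin k → V m) p → (∀ t → coord (v t) p ≡ 𝟘) →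
                coord (lincomb c v) p ≡ 𝟘
lincomb-zeros {zero} {m} c v p h = coord-zeroV {m} p
lincomb-zeros {suc k} c v p h = begin
  coord ((c zero ·V v zero) +V lincomb (λ t → c (suc t)) (λ t → v (suc t))) p
    ≡⟨ coord-+V (c zero ·V v zero) (lincomb (λ t → c (suc t)) (λ t → v (suc t))) p ⟩
  coord (c zero ·V v zero) p +F coord (lincomb (λ t → c (suc t)) (λ t → v (suc t))) p
    ≡⟨ cong₂ _+F_ (trans (coord-·V (c zero) (v zero) p) (trans (cong (c zero *F_) (h zero)) (*F-zeroʳ (c zero))))
                   (lincomb-zeros (λ t → c (suc t)) (λ t → v (suc t)) p (λ t → h (suc t))) ⟩
  𝟘 ∎
  where open ≡-Reasoning

InSpan-scale : ∀ {k m} (h : Fin k → V m) x c → InSpan h x → InSpan h (c ·V x)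
InSpan-scale h x c (cs , eq) = (λ t → c *F cs t) , trans (lincomb-scale c cs h) (cong (c ·V_) eq)

lincomb-cons0 : ∀ {k m} (c : Fin k → F4) (w : Fin k → V m) → lincomb c (λ t → 𝟘 ∷ w t) ≡ 𝟘 ∷ lincomb c w
lincomb-cons0 {zero} c w = refl
lincomb-cons0 {suc k} c w rewrite lincomb-cons0 (λ t → c (suc t)) (λ t → w (suc t)) | *F-zeroʳ (c zero) = refl

δ : ∀ {k} → Fin k → Fin k → F4
δ zero zero = 𝟙
δ zero (suc s) = 𝟘
δ (suc t) zero = 𝟘
δ (suc t) (suc s) = δ t s

lincomb-zero : ∀ {k m} (v : Fin k → V m) → lincomb (λ _ → 𝟘) v ≡ zeroV
lincomb-zero {zero} v = refl
lincomb-zero {suc k} v = trans (cong₂ _+V_ (·V-zero (v zero)) (lincomb-zero (λ t → v (suc t)))) (+V-idˡ zeroV)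

lincomb-δ : ∀ {k m} (t : Fin k) (v : Fin k → V m) → lincomb (δ t) v ≡ v t
lincomb-δ {suc k} zero v = trans (cong₂ _+V_ (·V-one (v zero)) (lincomb-zero (λ t → v (suc t)))) (+V-idʳ _)
lincomb-δ {suc k} (suc t) v = trans (cong₂ _+V_ (·V-zero (v zero)) (lincomb-δ t (λ s → v (suc s)))) (+V-idˡ _)

record Linear {m n : ℕ} (f : V m → V n) : Set where
  field
    additive : ∀ x y → f (x +V y) ≡ f x +V f y
    homogeneous : ∀ a x → f (a ·V x) ≡ a ·V f x

open Linear

linear-zero : ∀ {m n} (f : V m → V n) → Linear f → f zeroV ≡ zeroV
linear-zero {m} f lin = begin
  f zeroV            ≡⟨ cong f (sym (·V-zero {m} zeroV)) ⟩
  f (𝟘 ·V zeroV)     ≡⟨ homogeneous lin 𝟘 zeroV ⟩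
  𝟘 ·V f zeroV       ≡⟨ ·V-zero _ ⟩
  zeroV              ∎
  where open ≡-Reasoning

linear-lincomb : ∀ {k m n} (f : V m → V n) → Linear f → (c : Fin k → F4) (v : Fin k → V m) →
                 f (lincomb c v) ≡ lincomb c (λ t → f (v t))
linear-lincomb {zero} f lin c v = linear-zero f lin
linear-lincomb {suc k} f lin c v = begin
  f ((c zero ·V v zero) +V lincomb (λ t → c (suc t)) (λ t → v (suc t)))
    ≡⟨ additive lin _ _ ⟩
  f (c zero ·V v zero) +V f (lincomb (λ t → c (suc t)) (λ t → v (suc t)))
    ≡⟨ cong₂ _+V_ (homogeneous lin _ _) (linear-lincomb f lin (λ t → c (suc t)) (λ t → v (suc t))) ⟩
  lincomb c (λ t → f (v t)) ∎
  where open ≡-Reasoning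

-- Being a bijection, it permutes F4^m; since that is proved separately for
-- each elementary automorphism, it is recorded as invariance of sums.
record Aut (m : ℕ) : Set where
  field
    to from : V m → V m
    to-from : ∀ x → to (from x) ≡ x
    from-to : ∀ x → from (to x) ≡ x
    to-linear : Linear to
    to-sum : ∀ F → S m (λ x → F (to x)) ≡ S m F

  from-linear : Linear from
  from-linear = record
    { additive = λ x y → begin
        from (x +V y)                   ≡⟨ cong from (cong₂ _+V_ (sym (to-from x)) (sym (to-from y))) ⟩
        from (to (from x) +V to (from y)) ≡⟨ cong from (sym (additive to-linear (from x) (from y))) ⟩
        from (to (from x +V from y))    ≡⟨ from-to _ ⟩
        from x +V from y                ∎
    ; homogeneous = λ a x → begin
        from (a ·V x)                   ≡⟨ cong from (cong (a ·V_) (sym (to-from x))) ⟩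
        from (a ·V to (from x))         ≡⟨ cong from (sym (homogeneous to-linear a (from x))) ⟩
        from (to (a ·V from x))         ≡⟨ from-to _ ⟩
        a ·V from x                     ∎ }
    where open ≡-Reasoning

  from-sum : ∀ F → S m (λ x → F (from x)) ≡ S m F
  from-sum F = trans (sym (to-sum (λ x → F (from x)))) (S-cong m (λ x → cong F (from-to x)))

  to-injective : ∀ x y → to x ≡ to y → x ≡ y
  to-injective x y eq = trans (sym (from-to x)) (trans (cong from eq) (from-to y))

open Aut

idAut : ∀ {m} → Aut m
idAut = record
  { to = λ x → x ; from = λ x → x ; to-from = λ x → refl ; from-to = λ x → refl
  ; to-linear = record { additive = λ x y → refl ; homogeneous = λ a x → refl }
  ; to-sum = λ F → refl }

-- Composition B ∘ A (first A, then B).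
_∘A_ : ∀ {m} → Aut m → Aut m → Aut m
B ∘A A = record
  { to = λ x → to B (to A x)
  ; from = λ x → from A (from B x)
  ; to-from = λ x → trans (cong (to B) (to-from A (from B x))) (to-from B x)
  ; from-to = λ x → trans (cong (from A) (from-to B (to A x))) (from-to A x)
  ; to-linear = record
     { additive = λ x y → trans (cong (to B) (additive (to-linear A) x y)) (additive (to-linear B) _ _)
     ; homogeneous = λ a x → trans (cong (to B) (homogeneous (to-linear A) a x)) (homogeneous (to-linear B) _ _) }
  ; to-sum = λ F → trans (to-sum A (λ x → F (to B x))) (to-sum B F) }

liftAut : ∀ {m} → Aut m → Aut (suc m)
liftAut A = record
  { to = λ { (a ∷ x) → a ∷ to A x }
  ; from = λ { (a ∷ x) → a ∷ from A x }
  ; to-from = λ { (a ∷ x) → cong (a ∷_) (to-from A x) }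
  ; from-to = λ { (a ∷ x) → cong (a ∷_) (from-to A x) }
  ; to-linear = record
     { additive = λ { (a ∷ x) (b ∷ y) → cong ((a +F b) ∷_) (additive (to-linear A) x y) }
     ; homogeneous = λ { c (a ∷ x) → cong ((c *F a) ∷_) (homogeneous (to-linear A) c x) } }
  ; to-sum = λ F → F4sum-cong (λ a → to-sum A (λ x → F (a ∷ x))) }

shearMap : ∀ {m} → ℕ → V m → V m → V m
shearMap p v x = x +V (coord x p ·V v)

shearAut : ∀ {m} p (v : V m) → coord v p ≡ 𝟘 → Aut m
shearAut {m} p v vp0 = record
  { to = shearMap p v ; from = shearMap p v ; to-from = involutive ; from-to = involutive
  ; to-linear = record { additive = additive′ ; homogeneous = homogeneous′ }
  ; to-sum = λ F → S-shear m F p v vp0 }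
  where
  open ≡-Reasoning
  keeps-p : ∀ x → coord (shearMap p v x) p ≡ coord x p
  keeps-p x = begin
    coord (x +V (coord x p ·V v)) p          ≡⟨ coord-+V x (coord x p ·V v) p ⟩
    coord x p +F coord (coord x p ·V v) p    ≡⟨ cong (coord x p +F_) (coord-·V (coord x p) v p) ⟩
    coord x p +F (coord x p *F coord v p)    ≡⟨ cong (λ t → coord x p +F (coord x p *F t)) vp0 ⟩
    coord x p +F (coord x p *F 𝟘)            ≡⟨ cong (coord x p +F_) (*F-zeroʳ (coord x p)) ⟩
    coord x p +F 𝟘                           ≡⟨ +F-idʳ _ ⟩
    coord x p                                ∎
  involutive : ∀ x → shearMap p v (shearMap p v x) ≡ x
  involutive x = begin
    (x +V (coord x p ·V v)) +V (coord (shearMap p v x) p ·V v)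
      ≡⟨ cong (λ t → (x +V (coord x p ·V v)) +V (t ·V v)) (keeps-p x) ⟩
    (x +V (coord x p ·V v)) +V (coord x p ·V v)   ≡⟨ +V-assoc x _ _ ⟩
    x +V ((coord x p ·V v) +V (coord x p ·V v))   ≡⟨ cong (x +V_) (+V-self _) ⟩
    x +V zeroV                                    ≡⟨ +V-idʳ x ⟩
    x                                             ∎
  additive′ : ∀ x y → shearMap p v (x +V y) ≡ shearMap p v x +V shearMap p v y
  additive′ x y = begin
    (x +V y) +V (coord (x +V y) p ·V v)       ≡⟨ cong (λ t → (x +V y) +V (t ·V v)) (coord-+V x y p) ⟩
    (x +V y) +V ((coord x p +F coord y p) ·V v) ≡⟨ cong ((x +V y) +V_) (·V-distʳ _ _ v) ⟩
    (x +V y) +V ((coord x p ·V v) +V (coord y p ·V v)) ≡⟨ +V-inter x y _ _ ⟩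
    shearMap p v x +V shearMap p v y          ∎
  homogeneous′ : ∀ a x → shearMap p v (a ·V x) ≡ a ·V shearMap p v x
  homogeneous′ a x = begin
    (a ·V x) +V (coord (a ·V x) p ·V v)       ≡⟨ cong (λ t → (a ·V x) +V (t ·V v)) (coord-·V a x p) ⟩
    (a ·V x) +V ((a *F coord x p) ·V v)       ≡⟨ cong ((a ·V x) +V_) (sym (·V-assoc a (coord x p) v)) ⟩
    (a ·V x) +V (a ·V (coord x p ·V v))       ≡⟨ sym (·V-distˡ a x _) ⟩
    a ·V shearMap p v x                       ∎

scaleAt-inv : ∀ {m} p c (x : V m) → c ≢ 𝟘 → scaleAt p (inv c) (scaleAt p c x) ≡ x
scaleAt-inv p c [] nz = refl
scaleAt-inv zero c (a ∷ x) nz =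
  cong (_∷ x) (trans (sym (*F-assoc (inv c) c a)) (trans (cong (_*F a) (inv-l c nz)) (*F-oneˡ a)))
scaleAt-inv (suc p) c (a ∷ x) nz = cong (a ∷_) (scaleAt-inv p c x nz)

scaleAt-additive : ∀ {m} p c (x y : V m) → scaleAt p c (x +V y) ≡ scaleAt p c x +V scaleAt p c y
scaleAt-additive p c [] [] = refl
scaleAt-additive zero c (a ∷ x) (b ∷ y) = cong (_∷ (x +V y)) (*F-distˡ c a b)
scaleAt-additive (suc p) c (a ∷ x) (b ∷ y) = cong ((a +F b) ∷_) (scaleAt-additive p c x y)

scaleAt-homogeneous : ∀ {m} p c a (x : V m) → scaleAt p c (a ·V x) ≡ a ·V scaleAt p c x
scaleAt-homogeneous p c a [] = refl
scaleAt-homogeneous zero c a (b ∷ x) =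
  cong (_∷ (a ·V x)) (trans (sym (*F-assoc c a b)) (trans (cong (_*F b) (*F-comm c a)) (*F-assoc a c b)))
scaleAt-homogeneous (suc p) c a (b ∷ x) = cong ((a *F b) ∷_) (scaleAt-homogeneous p c a x)

scaleAt-fix : ∀ {m} p c (x : V m) → coord x p ≡ 𝟘 → scaleAt p c x ≡ x
scaleAt-fix p c [] h = refl
scaleAt-fix zero c (a ∷ x) h = cong (_∷ x) (trans (cong (c *F_) h) (trans (*F-zeroʳ c) (sym h)))
scaleAt-fix (suc p) c (a ∷ x) h = cong (a ∷_) (scaleAt-fix p c x h)

coord-scaleAt : ∀ {m} p c (x : V m) → coord (scaleAt p c x) p ≡ c *F coord x p
coord-scaleAt p c [] = sym (*F-zeroʳ c)
coord-scaleAt zero c (a ∷ x) = refl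
coord-scaleAt (suc p) c (a ∷ x) = coord-scaleAt p c x

scaleAut : ∀ {m} p c → c ≢ 𝟘 → Aut m
scaleAut {m} p c nz = record
  { to = scaleAt p c ; from = scaleAt p (inv c)
  ; to-from = λ x → trans (cong (λ t → scaleAt p t (scaleAt p (inv c) x)) (sym (inv-inv c)))
                          (scaleAt-inv p (inv c) x (inv-nz c nz))
  ; from-to = λ x → scaleAt-inv p c x nz
  ; to-linear = record { additive = scaleAt-additive p c ; homogeneous = scaleAt-homogeneous p c }
  ; to-sum = λ F → S-scaleAt m F p c nz }

-- For t : Fin j, tailPos m t = m - j + t: the t-th of the last j coordinate positions.
revIndex : ∀ {j} → Fin j → ℕ
revIndex {suc j} zero = j
revIndex {suc j} (suc t) = revIndex t

revIndex< : ∀ {j} (t : Fin j) → revIndex t < j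
revIndex< {suc j} zero = ≤-refl
revIndex< {suc j} (suc t) = m<n⇒m<1+n (revIndex< t)

tailPos : ℕ → ∀ {j} → Fin j → ℕ
tailPos m t = m ∸ suc (revIndex t)

below⇒≤ : ∀ p j m → p + j < m → p ≤ m ∸ suc j
below⇒≤ p j m lt = m+n≤o⇒m≤o∸n p (subst (_≤ m) (sym (+-suc p j)) lt)

below⇒room : ∀ p j m → p + j < m → suc j ≤ m
below⇒room p j m lt = ≤-trans (s≤s (m≤n+m j p)) lt

below-step : ∀ p j m → p + j < m → p ≢ m ∸ suc j → p + suc j < m
below-step p j m lt ne = m≤o∸n⇒m+n≤o (suc p) (below⇒room p j m lt) (≤∧≢⇒< (below⇒≤ p j m lt) ne)

tailPos-above : ∀ m j (t : Fin j) → suc j ≤ m → m ∸ suc j < tailPos m t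
tailPos-above m j t le = ∸-monoʳ-< (s≤s (revIndex< t)) le

tailPos-≢ : ∀ p m j (t : Fin j) → p + j < m → p ≢ tailPos m t
tailPos-≢ p m j t lt eq =
  <-irrefl refl (≤-<-trans (subst (_≤ m ∸ suc j) eq (below⇒≤ p j m lt)) (tailPos-above m j t (below⇒room p j m lt)))

span-tail-units : ∀ {m} j → j ≤ m → (u : V m) → (∀ p → p + j < m → coord u p ≡ 𝟘) →
                  u ≡ lincomb {j} (λ t → coord u (tailPos m t)) (λ t → e (tailPos m t))
span-tail-units {m} zero le u h = coord-ext u zeroV vanish
  where
  vanish : ∀ p → coord u p ≡ coord (zeroV {m}) p
  vanish p with p <? m
  ... | yes lt = trans (h p (subst (_< m) (sym (+-identityʳ p)) lt)) (sym (coord-zeroV {m} p))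
  ... | no nlt = trans (coord-out u p (≮⇒≥ nlt)) (sym (coord-zeroV {m} p))
span-tail-units {m} (suc j) le u h = begin
  u                                  ≡⟨ sym (+V-idʳ u) ⟩
  u +V zeroV                         ≡⟨ cong (u +V_) (sym (+V-self (cq ·V E))) ⟩
  u +V ((cq ·V E) +V (cq ·V E))      ≡⟨ sym (+V-assoc u _ _) ⟩
  u′ +V (cq ·V E)                    ≡⟨ +V-comm u′ _ ⟩
  (cq ·V E) +V u′                    ≡⟨ cong ((cq ·V E) +V_) IH ⟩
  (cq ·V E) +V lincomb {j} (λ t → coord u′ (tailPos m t)) (λ t → e {m} (tailPos m t))
    ≡⟨ cong ((cq ·V E) +V_) (lincomb-ccong _ _ _ same) ⟩
  (cq ·V E) +V lincomb {j} (λ t → coord u (tailPos m (suc t))) (λ t → e {m} (tailPos m (suc t))) ∎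
  where
  open ≡-Reasoning
  -- peel off the component along e q, q = m - (j + 1), and recurse
  q : ℕ
  q = m ∸ suc j
  cq : F4
  cq = coord u q
  E : V m
  E = e {m} q
  u′ : V m
  u′ = u +V (cq ·V E)
  coord-u′ : ∀ p → coord u′ p ≡ coord u p +F (cq *F coord E p)
  coord-u′ p = trans (coord-+V u (cq ·V E) p) (cong (coord u p +F_) (coord-·V cq E p))
  u′-below : ∀ p → p + j < m → coord u′ p ≡ 𝟘
  u′-below p lt with p ≟ q
  ... | yes refl = trans (coord-u′ q) (trans (cong (λ t → cq +F (cq *F t)) (coord-e-same {m} q (∸-monoʳ-< (s≤s z≤n) le)))
                     (trans (cong (cq +F_) (*F-oneʳ cq)) (+F-self cq)))
  ... | no ne = trans (coord-u′ p) (trans (cong (λ t → coord u p +F (cq *F t)) (coord-e-diff {m} q p ne))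
                     (trans (cong (coord u p +F_) (*F-zeroʳ cq))
                     (trans (+F-idʳ _) (h p (below-step p j m lt ne)))))
  IH : u′ ≡ lincomb {j} (λ t → coord u′ (tailPos m t)) (λ t → e {m} (tailPos m t))
  IH = span-tail-units j (≤-trans (n≤1+n j) le) u′ u′-below
  same : ∀ (t : Fin j) → coord u′ (tailPos m t) ≡ coord u (tailPos m t)
  same t = trans (coord-u′ (tailPos m t)) (trans (cong (λ x → coord u (tailPos m t) +F (cq *F x))
                  (coord-e-diff {m} q (tailPos m t) (λ eq → <-irrefl (sym eq) (tailPos-above m j t le))))
                  (trans (cong (coord u (tailPos m t) +F_) (*F-zeroʳ cq)) (+F-idʳ _)))

first-nonzero : ∀ {m} (u : V m) n → (∀ p → p < n → coord u p ≡ 𝟘) ⊎ Σ ℕ (λ p → p < n × coord u p ≢ 𝟘)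
first-nonzero u zero = inj₁ (λ p ())
first-nonzero u (suc n) with first-nonzero u n | coord u n ≟F 𝟘
... | inj₂ (p , lt , nz) | _ = inj₂ (p , m<n⇒m<1+n lt , nz)
... | inj₁ below | yes un0 = inj₁ upto
  where
  upto : ∀ p → p < suc n → coord u p ≡ 𝟘
  upto p lt with m≤n⇒m<n∨m≡n (≤-pred lt)
  ... | inj₁ l = below p l
  ... | inj₂ refl = un0
... | inj₁ below | no un≢0 = inj₂ (n , ≤-refl , un≢0)

prepend : ∀ {k} → F4 → (Fin k → F4) → Fin (suc k) → F4
prepend a c zero = a
prepend a c (suc t) = c t

indep-tail : ∀ {k m} (g : Fin (suc k) → V m) → Independent g → Independent (λ t → g (suc t))
indep-tail g ind c eq t = ind (prepend 𝟘 c) (trans (cong₂ _+V_ (·V-zero (g zero)) eq) (+V-idˡ zeroV)) (suc t)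

shear-fix : ∀ {m} p (v x : V m) → coord x p ≡ 𝟘 → shearMap p v x ≡ x
shear-fix p v x xp0 = begin
  x +V (coord x p ·V v)   ≡⟨ cong (λ t → x +V (t ·V v)) xp0 ⟩
  x +V (𝟘 ·V v)           ≡⟨ cong (x +V_) (·V-zero v) ⟩
  x +V zeroV              ≡⟨ +V-idʳ x ⟩
  x                       ∎
  where open ≡-Reasoning

move-nonzero : ∀ {m} (u : V m) p q → q < m → coord u p ≢ 𝟘 →
               Σ (Aut m) λ A → coord (to A u) q ≢ 𝟘 × (∀ x → coord x p ≡ 𝟘 → to A x ≡ x)
move-nonzero {m} u p q q<m up≢0 with coord u q ≟F 𝟘
... | no uq≢0 = idAut , uq≢0 , λ x _ → refl
... | yes uq0 = shearAut p (e {m} q) (coord-e-diff {m} q p p≢q) , nonzero ,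
                λ x xp0 → shear-fix p (e q) x xp0
  where
  open ≡-Reasoning
  p≢q : p ≢ q
  p≢q refl = up≢0 uq0
  nonzero : coord (shearMap p (e {m} q) u) q ≢ 𝟘
  nonzero sq0 = up≢0 (begin
    coord u p                               ≡⟨ sym (*F-oneʳ _) ⟩
    coord u p *F 𝟙                          ≡⟨ cong (coord u p *F_) (sym (coord-e-same {m} q q<m)) ⟩
    coord u p *F coord (e {m} q) q          ≡⟨ sym (coord-·V (coord u p) (e {m} q) q) ⟩
    coord (coord u p ·V e {m} q) q          ≡⟨ cong (_+F coord (coord u p ·V e {m} q) q) (sym uq0) ⟩
    coord u q +F coord (coord u p ·V e {m} q) q ≡⟨ sym (coord-+V u (coord u p ·V e {m} q) q) ⟩
    coord (shearMap p (e {m} q) u) q        ≡⟨ sq0 ⟩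
    𝟘                                       ∎)

clear-to-unit : ∀ {m} (u : V m) q → q < m → coord u q ≢ 𝟘 →
                Σ (Aut m) λ A → to A u ≡ e q × (∀ x → coord x q ≡ 𝟘 → to A x ≡ x)
clear-to-unit {m} u q q<m uq≢0 = shearAut q w wq0 ∘A scaleAut q α α≢0 , sends , fixes
  where
  open ≡-Reasoning
  α : F4
  α = inv (coord u q)
  α≢0 : α ≢ 𝟘
  α≢0 = inv-nz _ uq≢0
  u′ : V m
  u′ = scaleAt q α u
  u′q : coord u′ q ≡ 𝟙
  u′q = trans (coord-scaleAt q α u) (inv-l _ uq≢0)
  w : V m
  w = u′ +V e q
  wq0 : coord w q ≡ 𝟘
  wq0 = trans (coord-+V u′ (e q) q) (cong₂ _+F_ u′q (coord-e-same {m} q q<m))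
  sends : shearMap q w u′ ≡ e q
  sends = begin
    u′ +V (coord u′ q ·V w)  ≡⟨ cong (λ t → u′ +V (t ·V w)) u′q ⟩
    u′ +V (𝟙 ·V w)           ≡⟨ cong (u′ +V_) (·V-one w) ⟩
    u′ +V (u′ +V e q)        ≡⟨ sym (+V-assoc u′ u′ _) ⟩
    (u′ +V u′) +V e q        ≡⟨ cong (_+V e q) (+V-self u′) ⟩
    zeroV +V e q             ≡⟨ +V-idˡ _ ⟩
    e q                      ∎
  fixes : ∀ x → coord x q ≡ 𝟘 → shearMap q w (scaleAt q α x) ≡ x
  fixes x xq0 = trans (cong (shearMap q w) (scaleAt-fix q α x xq0)) (shear-fix q w x xq0)

eliminate : ∀ {m} (u : V m) p q → q < m → coord u p ≢ 𝟘 →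
            Σ (Aut m) λ A → to A u ≡ e q × (∀ x → coord x p ≡ 𝟘 → coord x q ≡ 𝟘 → to A x ≡ x)
eliminate u p q q<m up≢0 with move-nonzero u p q q<m up≢0
... | A₁ , nz , fix₁ with clear-to-unit (to A₁ u) q q<m nz
... | A₂ , sends , fix₂ =
  A₂ ∘A A₁ , sends , λ x xp0 xq0 → trans (cong (to A₂) (fix₁ x xp0)) (fix₂ x xq0)

elimination : ∀ {m} j (g : Fin j → V m) → Independent g →
              Σ (Aut m) λ A → j ≤ m × (∀ t → to A (g t) ≡ e (tailPos m t))
elimination {m} zero g ind = idAut , z≤n , λ ()
elimination {m} (suc j) g ind with elimination j (λ t → g (suc t)) (indep-tail g ind)
... | A , le , sends with first-nonzero (to A (g zero)) (m ∸ j)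
... | inj₁ vanish = ⊥-elim dependent
  where
  open ≡-Reasoning
  -- otherwise A (g 0) lies in the span of the images of the other vectors
  u = to A (g zero)
  c : Fin j → F4
  c t = coord u (tailPos m t)
  in-span : u ≡ to A (lincomb c (λ t → g (suc t)))
  in-span = begin
    u                                      ≡⟨ span-tail-units j le u (λ p lt → vanish p (m+n≤o⇒m≤o∸n (suc p) lt)) ⟩
    lincomb c (λ t → e (tailPos m t))      ≡⟨ lincomb-cong c _ _ (λ t → sym (sends t)) ⟩
    lincomb c (λ t → to A (g (suc t)))     ≡⟨ sym (linear-lincomb (to A) (to-linear A) c (λ t → g (suc t))) ⟩
    to A (lincomb c (λ t → g (suc t)))     ∎
  relation : lincomb (prepend 𝟙 c) g ≡ zeroV
  relation = trans (cong₂ _+V_ (·V-one (g zero)) (sym (to-injective A _ _ in-span))) (+V-self (g zero))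
  dependent : ⊥
  dependent with ind (prepend 𝟙 c) relation zero
  ... | ()
... | inj₂ (p , lt , nz) = E ∘A A , below⇒room p j m below , sends′
  where
  open ≡-Reasoning
  below : p + j < m
  below = m≤o∸n⇒m+n≤o (suc p) le lt
  q = m ∸ suc j
  step = eliminate (to A (g zero)) p q (∸-monoʳ-< (s≤s z≤n) (below⇒room p j m below)) nz
  E = proj₁ step
  sends′ : ∀ t → to E (to A (g t)) ≡ e (tailPos m t)
  sends′ zero = proj₁ (proj₂ step)
  sends′ (suc t) = begin
    to E (to A (g (suc t)))   ≡⟨ cong (to E) (sends t) ⟩
    to E (e (tailPos m t))    ≡⟨ proj₂ (proj₂ step) (e (tailPos m t))
        (coord-e-diff {m} (tailPos m t) p (tailPos-≢ p m j t below))
        (coord-e-diff {m} (tailPos m t) q (λ eq → <-irrefl eq (tailPos-above m j t (below⇒room p j m below)))) ⟩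
    e (tailPos m t)           ∎

-- Only the specification of the elimination is used later; keeping it abstract
-- stops the type checker from unfolding the construction.
abstract
  gauss : ∀ {m} j (g : Fin j → V m) → Independent g →
          Σ (Aut m) λ A → j ≤ m × (∀ t → to A (g t) ≡ e (tailPos m t))
  gauss = elimination

isZ : ∀ {m} → V m → Bool
isZ [] = true
isZ (𝟘 ∷ x) = isZ x
isZ (𝟙 ∷ x) = false
isZ (ω ∷ x) = false
isZ (ω² ∷ x) = false

lead : ∀ {m} → V m → F4
lead [] = 𝟘
lead (𝟘 ∷ x) = lead x
lead (𝟙 ∷ x) = 𝟙
lead (ω ∷ x) = ω
lead (ω² ∷ x) = ω²

norm : ∀ {m} → V m → V m
norm v = inv (lead v) ·V v

isZ-true : ∀ {m} (v : V m) → isZ v ≡ true → v ≡ zeroV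
isZ-true [] h = refl
isZ-true (𝟘 ∷ v) h = cong (𝟘 ∷_) (isZ-true v h)

isZ-zeroV : ∀ {m} → isZ (zeroV {m}) ≡ true
isZ-zeroV {zero} = refl
isZ-zeroV {suc m} = isZ-zeroV {m}

nonzero⇒isZ-false : ∀ {m} (v : V m) → v ≢ zeroV → isZ v ≡ false
nonzero⇒isZ-false v ne with isZ v in eq
... | true = ⊥-elim (ne (isZ-true v eq))
... | false = refl

isZ-false⇒nonzero : ∀ {m} (v : V m) → isZ v ≡ false → v ≢ zeroV
isZ-false⇒nonzero {m} v h refl with trans (sym h) (isZ-zeroV {m})
... | ()

isNorm⇒nonzero : ∀ {m} (v : V m) → T (isNorm v) → isZ v ≡ false
isNorm⇒nonzero (𝟘 ∷ v) h = isNorm⇒nonzero v h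
isNorm⇒nonzero (𝟙 ∷ v) h = refl

lead-nz : ∀ {m} (v : V m) → isZ v ≡ false → lead v ≢ 𝟘
lead-nz (𝟘 ∷ v) h = lead-nz v h
lead-nz (𝟙 ∷ v) h ()
lead-nz (ω ∷ v) h ()
lead-nz (ω² ∷ v) h ()

lead-isNorm : ∀ {m} (v : V m) → T (isNorm v) → lead v ≡ 𝟙
lead-isNorm (𝟘 ∷ v) h = lead-isNorm v h
lead-isNorm (𝟙 ∷ v) h = refl

norm-id : ∀ {m} (v : V m) → T (isNorm v) → norm v ≡ v
norm-id v h = trans (cong (λ t → inv t ·V v) (lead-isNorm v h)) (·V-one v)

norm-isNorm : ∀ {m} (v : V m) → isZ v ≡ false → T (isNorm (norm v))
norm-isNorm (𝟘 ∷ v) h rewrite *F-zeroʳ (inv (lead v)) = norm-isNorm v h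
norm-isNorm (𝟙 ∷ v) h = tt
norm-isNorm (ω ∷ v) h = tt
norm-isNorm (ω² ∷ v) h = tt

lead-cons : ∀ {m} b (x : V m) → b ≢ 𝟘 → lead (b ∷ x) ≡ b
lead-cons 𝟘 x nz = ⊥-elim (nz refl)
lead-cons 𝟙 x nz = refl
lead-cons ω x nz = refl
lead-cons ω² x nz = refl

lead-scale : ∀ {m} c (v : V m) → c ≢ 𝟘 → lead (c ·V v) ≡ c *F lead v
lead-scale c [] nz = sym (*F-zeroʳ c)
lead-scale c (𝟘 ∷ v) nz rewrite *F-zeroʳ c = lead-scale c v nz
lead-scale c (𝟙 ∷ v) nz = lead-cons _ _ (mul-nz c 𝟙 nz (λ ()))
lead-scale c (ω ∷ v) nz = lead-cons _ _ (mul-nz c ω nz (λ ()))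
lead-scale c (ω² ∷ v) nz = lead-cons _ _ (mul-nz c ω² nz (λ ()))

norm-scale : ∀ {m} c (v : V m) → c ≢ 𝟘 → norm (c ·V v) ≡ norm v
norm-scale c v nz = begin
  inv (lead (c ·V v)) ·V (c ·V v)   ≡⟨ cong (λ t → inv t ·V (c ·V v)) (lead-scale c v nz) ⟩
  inv (c *F lead v) ·V (c ·V v)     ≡⟨ ·V-assoc _ c v ⟩
  (inv (c *F lead v) *F c) ·V v     ≡⟨ cong (_·V v) (inv-cancel c (lead v) nz) ⟩
  inv (lead v) ·V v                 ∎
  where open ≡-Reasoning

norm-lead : ∀ {m} (v : V m) → v ≡ lead v ·V norm v
norm-lead [] = refl
norm-lead (𝟘 ∷ v) = cong₂ _∷_ (sym (trans (cong (lead v *F_) (*F-zeroʳ (inv (lead v)))) (*F-zeroʳ (lead v)))) (norm-lead v)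
norm-lead (𝟙 ∷ v) = cong (𝟙 ∷_) (sym (trans (·V-assoc 𝟙 𝟙 v) (·V-one v)))
norm-lead (ω ∷ v) = cong (ω ∷_) (sym (trans (·V-assoc ω ω² v) (·V-one v)))
norm-lead (ω² ∷ v) = cong (ω² ∷_) (sym (trans (·V-assoc ω² ω v) (·V-one v)))

normPt : ∀ {m} (v : V m) → isZ v ≡ false → Pt m
normPt v h = norm v , norm-isNorm v h

scale-isNorm-zero : ∀ {m} α (x : V m) → T (isNorm x) → α ·V x ≡ zeroV → α ≡ 𝟘
scale-isNorm-zero α (𝟘 ∷ x) h eq = scale-isNorm-zero α x h (cong tail eq)
scale-isNorm-zero α (𝟙 ∷ x) h eq = trans (sym (*F-oneʳ α)) (cong head eq)

scale-nonzero-zero : ∀ {m} α (x : V m) → α ≢ 𝟘 → α ·V x ≡ zeroV → x ≡ zeroV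
scale-nonzero-zero α x nz eq = begin
  x                    ≡⟨ sym (·V-one x) ⟩
  𝟙 ·V x               ≡⟨ cong (_·V x) (sym (inv-l α nz)) ⟩
  (inv α *F α) ·V x    ≡⟨ sym (·V-assoc (inv α) α x) ⟩
  inv α ·V (α ·V x)    ≡⟨ cong (inv α ·V_) eq ⟩
  inv α ·V zeroV       ≡⟨ ·V-zeroV (inv α) ⟩
  zeroV                ∎
  where open ≡-Reasoning

distinct-independent : ∀ {m} (x y : V m) → T (isNorm x) → T (isNorm y) → x ≢ y → ∀ α β →
                       (α ·V x) +V (β ·V y) ≡ zeroV → α ≡ 𝟘 × β ≡ 𝟘
distinct-independent (𝟘 ∷ x) (𝟘 ∷ y) hx hy ne α β eq =
  distinct-independent x y hx hy (λ e → ne (cong (𝟘 ∷_) e)) α β (cong tail eq)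
distinct-independent (𝟘 ∷ x) (𝟙 ∷ y) hx hy ne α β eq = scale-isNorm-zero α x hx αx0 , β0
  where
  β0 : β ≡ 𝟘
  β0 = trans (sym (*F-oneʳ β)) (trans (cong (_+F (β *F 𝟙)) (sym (*F-zeroʳ α))) (cong head eq))
  αx0 : α ·V x ≡ zeroV
  αx0 = trans (sym (+V-idʳ _)) (trans (cong ((α ·V x) +V_) (sym (trans (cong (_·V y) β0) (·V-zero y)))) (cong tail eq))
distinct-independent (𝟙 ∷ x) (𝟘 ∷ y) hx hy ne α β eq = α0 , scale-isNorm-zero β y hy βy0
  where
  α0 : α ≡ 𝟘
  α0 = trans (sym (*F-oneʳ α)) (trans (sym (+F-idʳ _)) (trans (cong ((α *F 𝟙) +F_) (sym (*F-zeroʳ β))) (cong head eq)))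
  βy0 : β ·V y ≡ zeroV
  βy0 = trans (sym (+V-idˡ _)) (trans (cong (_+V (β ·V y)) (sym (trans (cong (_·V x) α0) (·V-zero x)))) (cong tail eq))
distinct-independent (𝟙 ∷ x) (𝟙 ∷ y) hx hy ne α β eq with α ≟F 𝟘
... | yes α0 = α0 , trans (sym α≡β) α0
  where
  α≡β : α ≡ β
  α≡β = sum0 α β (trans (cong₂ _+F_ (sym (*F-oneʳ α)) (sym (*F-oneʳ β))) (cong head eq))
... | no α≢0 = ⊥-elim (ne (cong (𝟙 ∷_) (sum0V x y (scale-nonzero-zero α _ α≢0 (trans (·V-distˡ α x y) αx+αy0)))))
  where
  α≡β : α ≡ β
  α≡β = sum0 α β (trans (cong₂ _+F_ (sym (*F-oneʳ α)) (sym (*F-oneʳ β))) (cong head eq))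
  αx+αy0 : (α ·V x) +V (α ·V y) ≡ zeroV
  αx+αy0 = trans (cong (λ t → (α ·V x) +V (t ·V y)) α≡β) (cong tail eq)

InSpan-unnorm : ∀ {k m} (h : Fin k → V m) x → InSpan h (norm x) → InSpan h x
InSpan-unnorm h x sp = subst (InSpan h) (sym (norm-lead x)) (InSpan-scale h (norm x) (lead x) sp)

independent-nonzero : ∀ {k m} (w : Fin k → V m) → Independent w → ∀ t → isZ (w t) ≡ false
independent-nonzero w ind t = nonzero⇒isZ-false (w t) λ wt0 → δ-diag t (ind (δ t) (trans (lincomb-δ t w) wt0) t)
  where
  δ-diag : ∀ {k} (t : Fin k) → δ t t ≡ 𝟘 → ⊥
  δ-diag zero ()
  δ-diag (suc t) h = δ-diag t h

combine-combinations : ∀ {m} α β a b a′ b′ (p q : V m) →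
  (α ·V ((a ·V p) +V (b ·V q))) +V (β ·V ((a′ ·V p) +V (b′ ·V q)))
  ≡ (((α *F a) +F (β *F a′)) ·V p) +V (((α *F b) +F (β *F b′)) ·V q)
combine-combinations α β a b a′ b′ p q = begin
  (α ·V ((a ·V p) +V (b ·V q))) +V (β ·V ((a′ ·V p) +V (b′ ·V q)))
    ≡⟨ cong₂ _+V_ (·V-distˡ α _ _) (·V-distˡ β _ _) ⟩
  ((α ·V (a ·V p)) +V (α ·V (b ·V q))) +V ((β ·V (a′ ·V p)) +V (β ·V (b′ ·V q)))
    ≡⟨ cong₂ _+V_ (cong₂ _+V_ (·V-assoc α a p) (·V-assoc α b q)) (cong₂ _+V_ (·V-assoc β a′ p) (·V-assoc β b′ q)) ⟩
  (((α *F a) ·V p) +V ((α *F b) ·V q)) +V (((β *F a′) ·V p) +V ((β *F b′) ·V q))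
    ≡⟨ +V-inter _ _ _ _ ⟩
  (((α *F a) ·V p) +V ((β *F a′) ·V p)) +V (((α *F b) ·V q) +V ((β *F b′) ·V q))
    ≡⟨ sym (cong₂ _+V_ (·V-distʳ _ _ p) (·V-distʳ _ _ q)) ⟩
  (((α *F a) +F (β *F a′)) ·V p) +V (((α *F b) +F (β *F b′)) ·V q) ∎
  where open ≡-Reasoning

OnLine-trans : ∀ {m} (p q x y z : Pt m) → OnLine p q x → OnLine p q y → OnLine x y z → OnLine p q z
OnLine-trans p q x y z (a , b , ex) (a′ , b′ , ey) (α , β , ez) =
  _ , _ , trans ez (trans (cong₂ (λ s t → (α ·V s) +V (β ·V t)) ex ey)
                         (combine-combinations α β a b a′ b′ (proj₁ p) (proj₁ q)))

OnLine-left : ∀ {m} (x y : Pt m) → OnLine x y x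
OnLine-left x y = 𝟙 , 𝟘 , sym (trans (cong₂ _+V_ (·V-one _) (·V-zero _)) (+V-idʳ _))

OnLine-right : ∀ {m} (x y : Pt m) → OnLine x y y
OnLine-right x y = 𝟘 , 𝟙 , sym (trans (cong₂ _+V_ (·V-zero _) (·V-one _)) (+V-idˡ _))

RetainsOnly : ∀ {m} → PtSet m → Pt m → Pt m → Set
RetainsOnly {m} R x y = (proj₁ x ≢ proj₁ y) × Retained R x × Retained R y ×
  (∀ (z : Pt m) → OnLine x y z → Retained R z → (proj₁ z ≡ proj₁ x) ⊎ (proj₁ z ≡ proj₁ y))

legal-intro : ∀ {m} (R : PtSet m) → (∀ x y → RetainsOnly R x y → ⊥) → Legal R
legal-intro R none p q p≢q (x , y , ox , oy , rx , ry , x≢y , only) =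
  none x y (x≢y , rx , ry , λ z oz rz → only z (OnLine-trans p q x y z ox oy oz) rz)

legal-elim : ∀ {m} (R : PtSet m) → Legal R → ∀ x y → RetainsOnly R x y → ⊥
legal-elim R legal x y (x≢y , rx , ry , only) =
  legal x y x≢y (x , y , OnLine-left x y , OnLine-right x y , rx , ry , x≢y , only)

module ThirdPoint {m} (x y : Pt m) (x≢y : proj₁ x ≢ proj₁ y) (c : F4) (c≢0 : c ≢ 𝟘) where
  open ≡-Reasoning
  private
    xv = proj₁ x
    yv = proj₁ y
    independent = distinct-independent xv yv (proj₂ x) (proj₂ y) x≢y
    w = xv +V (c ·V yv)
    w-nz : isZ w ≡ false
    w-nz = nonzero⇒isZ-false w λ w0 → 𝟙≢𝟘 (proj₁ (independent 𝟙 c (trans (cong (_+V (c ·V yv)) (·V-one xv)) w0)))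
    ℓ = inv (lead w)
    ℓ≢0 : ℓ ≢ 𝟘
    ℓ≢0 = inv-nz _ (lead-nz w w-nz)

  point : Pt m
  point = normPt w w-nz

  private
    point≡ : proj₁ point ≡ (ℓ ·V xv) +V ((ℓ *F c) ·V yv)
    point≡ = trans (·V-distˡ ℓ xv _) (cong ((ℓ ·V xv) +V_) (·V-assoc ℓ c yv))

  on-line : OnLine x y point
  on-line = ℓ , ℓ *F c , point≡

  point≢x : proj₁ point ≢ xv
  point≢x p≡x = mul-nz ℓ c ℓ≢0 c≢0 (proj₂ (independent (ℓ +F 𝟙) (ℓ *F c) (begin
    ((ℓ +F 𝟙) ·V xv) +V ((ℓ *F c) ·V yv)
      ≡⟨ cong (_+V ((ℓ *F c) ·V yv)) (trans (·V-distʳ ℓ 𝟙 xv) (trans (cong ((ℓ ·V xv) +V_) (·V-one xv)) (+V-comm _ xv))) ⟩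
    (xv +V (ℓ ·V xv)) +V ((ℓ *F c) ·V yv)   ≡⟨ +V-assoc xv _ _ ⟩
    xv +V ((ℓ ·V xv) +V ((ℓ *F c) ·V yv))   ≡⟨ cong (xv +V_) (trans (sym point≡) p≡x) ⟩
    xv +V xv                                ≡⟨ +V-self xv ⟩
    zeroV                                   ∎)))

  point≢y : proj₁ point ≢ yv
  point≢y p≡y = ℓ≢0 (proj₁ (independent ℓ ((ℓ *F c) +F 𝟙) (begin
    (ℓ ·V xv) +V (((ℓ *F c) +F 𝟙) ·V yv)
      ≡⟨ cong ((ℓ ·V xv) +V_) (trans (·V-distʳ (ℓ *F c) 𝟙 yv) (cong (((ℓ *F c) ·V yv) +V_) (·V-one yv))) ⟩
    (ℓ ·V xv) +V (((ℓ *F c) ·V yv) +V yv)   ≡⟨ sym (+V-assoc _ _ yv) ⟩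
    ((ℓ ·V xv) +V ((ℓ *F c) ·V yv)) +V yv   ≡⟨ cong (_+V yv) (trans (sym point≡) p≡y) ⟩
    yv +V yv                                ≡⟨ +V-self yv ⟩
    zeroV                                   ∎)))

  vanishes : ∀ i → coord (proj₁ point) i ≡ 𝟘 → coord xv i +F (c *F coord yv i) ≡ 𝟘
  vanishes i pi0 with mul-zero ℓ (coord w i) (trans (sym (coord-·V ℓ w i)) pi0)
  ... | inj₁ ℓ0 = ⊥-elim (ℓ≢0 ℓ0)
  ... | inj₂ wi0 = trans (cong (coord xv i +F_) (sym (coord-·V c yv i))) (trans (sym (coord-+V xv (c ·V yv) i)) wi0)

c·[a·x+b·y] : ∀ {m} c a b d d′ (x y : V m) →
  c ·V ((a ·V (d ·V x)) +V (b ·V (d′ ·V y))) ≡ ((c *F (a *F d)) ·V x) +V ((c *F (b *F d′)) ·V y)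
c·[a·x+b·y] c a b d d′ x y = begin
  c ·V ((a ·V (d ·V x)) +V (b ·V (d′ ·V y)))
    ≡⟨ ·V-distˡ c _ _ ⟩
  (c ·V (a ·V (d ·V x))) +V (c ·V (b ·V (d′ ·V y)))
    ≡⟨ cong₂ _+V_ (trans (cong (c ·V_) (·V-assoc a d x)) (·V-assoc c _ x))
                   (trans (cong (c ·V_) (·V-assoc b d′ y)) (·V-assoc c _ y)) ⟩
  ((c *F (a *F d)) ·V x) +V ((c *F (b *F d′)) ·V y) ∎
  where open ≡-Reasoning

-- A chart identifies the subspace Sub of F4^mb with F4^mt: emb is a linear
-- embedding onto Sub with inverse coords (also linear).
record Chart {mb mt : ℕ} (coords : V mb → V mt) (emb : V mt → V mb) (Sub : V mb → Set) : Set where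
  field
    coords-linear : Linear coords
    emb-linear : Linear emb
    emb-coords : ∀ v → Sub v → emb (coords v) ≡ v
    coords-emb : ∀ w → coords (emb w) ≡ w
    emb-in-Sub : ∀ w → Sub (emb w)
    Sub-scale : ∀ c v → Sub v → Sub (c ·V v)

-- If Rb restricted to the subspace Sub is the legal set Rt read in the chart,
-- then no line of the subspace retains exactly two points of Rb.
module ChartLegality {mb mt} {coords : V mb → V mt} {emb : V mt → V mb} {Sub : V mb → Set}
  (chart : Chart coords emb Sub) (Rb : PtSet mb) (Rt : PtSet mt)
  (agree : ∀ v → T (isNorm v) → Sub v → Rt (norm (coords v)) ≡ Rb v) where
  open Chart chart
  open ≡-Reasoning

  coords-nz : ∀ v → T (isNorm v) → Sub v → isZ (coords v) ≡ false
  coords-nz v hn s = nonzero⇒isZ-false (coords v) λ c0 → isZ-false⇒nonzero v (isNorm⇒nonzero v hn)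
    (trans (sym (emb-coords v s)) (trans (cong emb c0) (linear-zero emb emb-linear)))

  emb-nz : ∀ w → T (isNorm w) → isZ (emb w) ≡ false
  emb-nz w hn = nonzero⇒isZ-false (emb w) λ e0 → isZ-false⇒nonzero w (isNorm⇒nonzero w hn)
    (trans (sym (coords-emb w)) (trans (cong coords e0) (linear-zero coords coords-linear)))

  image : (x : Pt mb) → Sub (proj₁ x) → Pt mt
  image x s = normPt (coords (proj₁ x)) (coords-nz (proj₁ x) (proj₂ x) s)

  module _ (x y : Pt mb) (sx : Sub (proj₁ x)) (sy : Sub (proj₁ y)) (x≢y : proj₁ x ≢ proj₁ y) where
    xv = proj₁ x
    yv = proj₁ y
    ℓx = lead (coords xv)
    ℓy = lead (coords yv)

    emb-image-x : emb (proj₁ (image x sx)) ≡ inv ℓx ·V xv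
    emb-image-x = trans (homogeneous emb-linear (inv ℓx) (coords xv)) (cong (inv ℓx ·V_) (emb-coords xv sx))

    emb-image-y : emb (proj₁ (image y sy)) ≡ inv ℓy ·V yv
    emb-image-y = trans (homogeneous emb-linear (inv ℓy) (coords yv)) (cong (inv ℓy ·V_) (emb-coords yv sy))

    images-distinct : proj₁ (image x sx) ≢ proj₁ (image y sy)
    images-distinct same = lead-nz (coords yv) (coords-nz yv (proj₂ y) sy)
      (proj₁ (distinct-independent xv yv (proj₂ x) (proj₂ y) x≢y ℓy ℓx relation))
      where
      n = norm (coords xv)
      x≡ : xv ≡ ℓx ·V emb n
      x≡ = trans (sym (emb-coords xv sx)) (trans (cong emb (norm-lead (coords xv))) (homogeneous emb-linear ℓx n))
      y≡ : yv ≡ ℓy ·V emb n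
      y≡ = trans (sym (emb-coords yv sy))
             (trans (cong emb (trans (norm-lead (coords yv)) (cong (ℓy ·V_) (sym same)))) (homogeneous emb-linear ℓy n))
      relation : (ℓy ·V xv) +V (ℓx ·V yv) ≡ zeroV
      relation = begin
        (ℓy ·V xv) +V (ℓx ·V yv)                     ≡⟨ cong₂ (λ s t → (ℓy ·V s) +V (ℓx ·V t)) x≡ y≡ ⟩
        (ℓy ·V (ℓx ·V emb n)) +V (ℓx ·V (ℓy ·V emb n)) ≡⟨ cong₂ _+V_ (·V-assoc ℓy ℓx _) (·V-assoc ℓx ℓy _) ⟩
        ((ℓy *F ℓx) ·V emb n) +V ((ℓx *F ℓy) ·V emb n) ≡⟨ cong (λ t → ((ℓy *F ℓx) ·V emb n) +V (t ·V emb n)) (*F-comm ℓx ℓy) ⟩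
        ((ℓy *F ℓx) ·V emb n) +V ((ℓy *F ℓx) ·V emb n) ≡⟨ +V-self _ ⟩
        zeroV                                         ∎

    preimage : (z′ : Pt mt) → OnLine (image x sx) (image y sy) z′ →
               Σ (Pt mb) λ z → OnLine x y z × Σ (Sub (proj₁ z)) λ sz → proj₁ (image z sz) ≡ proj₁ z′
    preimage z′ (a , b , ez) = z , on-line , sz , back
      where
      w = emb (proj₁ z′)
      ℓ = lead w
      w-nz = emb-nz (proj₁ z′) (proj₂ z′)
      z : Pt mb
      z = normPt w w-nz
      sz : Sub (proj₁ z)
      sz = Sub-scale (inv ℓ) w (emb-in-Sub (proj₁ z′))
      on-line : OnLine x y z
      on-line = _ , _ , (begin
        inv ℓ ·V w                                     ≡⟨ cong (λ t → inv ℓ ·V emb t) ez ⟩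
        inv ℓ ·V emb ((a ·V _) +V (b ·V _))            ≡⟨ cong (inv ℓ ·V_) (additive emb-linear _ _) ⟩
        inv ℓ ·V (emb (a ·V _) +V emb (b ·V _))
          ≡⟨ cong (inv ℓ ·V_) (cong₂ _+V_ (trans (homogeneous emb-linear a _) (cong (a ·V_) emb-image-x))
                                           (trans (homogeneous emb-linear b _) (cong (b ·V_) emb-image-y))) ⟩
        inv ℓ ·V ((a ·V (inv ℓx ·V xv)) +V (b ·V (inv ℓy ·V yv))) ≡⟨ c·[a·x+b·y] (inv ℓ) a b (inv ℓx) (inv ℓy) xv yv ⟩
        _                                              ∎)
      back : norm (coords (inv ℓ ·V w)) ≡ proj₁ z′
      back = begin
        norm (coords (inv ℓ ·V w))  ≡⟨ cong norm (homogeneous coords-linear (inv ℓ) w) ⟩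
        norm (inv ℓ ·V coords w)    ≡⟨ cong (λ t → norm (inv ℓ ·V t)) (coords-emb (proj₁ z′)) ⟩
        norm (inv ℓ ·V proj₁ z′)    ≡⟨ norm-scale (inv ℓ) (proj₁ z′) (inv-nz ℓ (lead-nz w w-nz)) ⟩
        norm (proj₁ z′)             ≡⟨ norm-id (proj₁ z′) (proj₂ z′) ⟩
        proj₁ z′                    ∎

  no-retains-only : Legal Rt → ∀ (x y : Pt mb) → Sub (proj₁ x) → Sub (proj₁ y) → RetainsOnly Rb x y → ⊥
  no-retains-only legal x y sx sy (x≢y , rx , ry , only) =
    legal-elim Rt legal (image x sx) (image y sy)
      (images-distinct x y sx sy x≢y , trans (agree _ (proj₂ x) sx) rx , trans (agree _ (proj₂ y) sy) ry , only′)
    where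
    only′ : ∀ (z′ : Pt mt) → OnLine (image x sx) (image y sy) z′ → Retained Rt z′ →
            (proj₁ z′ ≡ proj₁ (image x sx)) ⊎ (proj₁ z′ ≡ proj₁ (image y sy))
    only′ z′ oz′ rz′ with preimage x y sx sy x≢y z′ oz′
    ... | z , oz , sz , back with only z oz (trans (sym (agree (proj₁ z) (proj₂ z) sz)) (trans (cong Rt back) rz′))
    ...   | inj₁ z≡x = inj₁ (trans (sym back) (cong (λ t → norm (coords t)) z≡x))
    ...   | inj₂ z≡y = inj₂ (trans (sym back) (cong (λ t → norm (coords t)) z≡y))

transport : ∀ {m} → Aut m → PtSet m → PtSet m
transport A R v = R (norm (from A v))

-- Automorphisms preserve legality (a chart of the whole space) ...
transport-legal : ∀ {m} (A : Aut m) (R : PtSet m) → Legal R → Legal (transport A R)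
transport-legal {m} A R legal =
  legal-intro (transport A R) (λ x y → no-retains-only legal x y tt tt)
  where
  whole : Chart (from A) (to A) (λ _ → ⊤)
  whole = record { coords-linear = from-linear A ; emb-linear = to-linear A
                 ; emb-coords = λ v _ → to-from A v ; coords-emb = λ w → from-to A w
                 ; emb-in-Sub = λ _ → tt ; Sub-scale = λ _ _ _ → tt }
  open ChartLegality whole (transport A R) R (λ v _ _ → refl)

isZ-aut : ∀ {m} (A : Aut m) v → isZ (from A v) ≡ isZ v
isZ-aut {m} A v with isZ v in eq
... | true rewrite isZ-true v eq = trans (cong isZ (linear-zero (from A) (from-linear A))) (isZ-zeroV {m})
... | false = nonzero⇒isZ-false (from A v) λ e0 → isZ-false⇒nonzero v eq
                (trans (sym (to-from A v)) (trans (cong (to A) e0) (linear-zero (to A) (to-linear A))))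

-- Each point has three nonzero representatives: summing a scale-invariant F over
-- the nonzero vectors gives three times its sum over the normalised ones.
sum-nonzero : ∀ m (F : V m → ℕ) → (∀ c v → c ≢ 𝟘 → F (c ·V v) ≡ F v) →
              S m (λ v → if isZ v then 0 else F v) ≡ 3 * S m (λ v → if isNorm v then F v else 0)
sum-nonzero zero F invariant = refl
sum-nonzero (suc m) F invariant = begin
  S m (λ x → if isZ x then 0 else F (𝟘 ∷ x)) + (S m (λ x → F (𝟙 ∷ x)) + (S m (λ x → F (ω ∷ x)) + S m (λ x → F (ω² ∷ x))))
    ≡⟨ cong₂ (λ s t → s + (S m (λ x → F (𝟙 ∷ x)) + t)) IH (cong₂ _+_ (rescaled ω ω² (λ ()) refl) (rescaled ω² ω (λ ()) refl)) ⟩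
  3 * A + (B + (B + B))
    ≡⟨ solve 2 (λ a b → con 3 :* a :+ (b :+ (b :+ b)) := con 3 :* (a :+ (b :+ (con 0 :+ con 0)))) refl A B ⟩
  3 * (A + (B + (0 + 0)))
    ≡⟨ cong (λ t → 3 * (A + (B + (t + t)))) (sym (S-zero m)) ⟩
  3 * (A + (B + (S m (λ _ → 0) + S m (λ _ → 0)))) ∎
  where
  open ≡-Reasoning
  A = S m (λ x → if isNorm x then F (𝟘 ∷ x) else 0)
  B = S m (λ x → F (𝟙 ∷ x))
  IH : S m (λ x → if isZ x then 0 else F (𝟘 ∷ x)) ≡ 3 * A
  IH = sum-nonzero m (λ x → F (𝟘 ∷ x))
         (λ c v nz → trans (cong (λ t → F (t ∷ (c ·V v))) (sym (*F-zeroʳ c))) (invariant c (𝟘 ∷ v) nz))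
  -- vectors with leading coordinate a ≠ 0 are rescalings of those with leading 𝟙
  rescaled : ∀ a c → c ≢ 𝟘 → c *F a ≡ 𝟙 → S m (λ x → F (a ∷ x)) ≡ B
  rescaled a c c≢0 ca≡1 =
    trans (S-cong m (λ x → trans (sym (invariant c (a ∷ x) c≢0)) (cong (λ t → F (t ∷ (c ·V x))) ca≡1)))
          (S-scale m (λ x → F (𝟙 ∷ x)) c c≢0)

numPts-as-sum : ∀ {m} (R : PtSet m) → numPts R ≡ S m (λ v → if isNorm v then b2n (R v) else 0)
numPts-as-sum {m} R = trans (countS m (λ v → isNorm v ∧ R v)) (S-cong m same)
  where
  same : ∀ v → b2n (isNorm v ∧ R v) ≡ (if isNorm v then b2n (R v) else 0)
  same v with isNorm v
  ... | true = refl
  ... | false = refl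

-- ... and the number of removed points: both counts are a third of the number of
-- nonzero vectors representing removed points, which the automorphism permutes.
transport-numPts : ∀ {m} (A : Aut m) (R : PtSet m) → numPts (transport A R) ≡ numPts R
transport-numPts {m} A R = *-cancelˡ-≡ (numPts (transport A R)) (numPts R) 3 (begin
  3 * numPts (transport A R)                         ≡⟨ cong (3 *_) (numPts-as-sum (transport A R)) ⟩
  3 * S m (λ v → if isNorm v then F′ v else 0)       ≡⟨ sym (sum-nonzero m F′ F′-invariant) ⟩
  S m (λ v → if isZ v then 0 else F′ v)              ≡⟨ S-cong m (λ v → cong (λ b → if b then 0 else F′ v) (sym (isZ-aut A v))) ⟩
  S m (λ v → H (from A v))                           ≡⟨ from-sum A H ⟩
  S m H                                              ≡⟨ sum-nonzero m removed removed-invariant ⟩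
  3 * S m (λ v → if isNorm v then removed v else 0)  ≡⟨ cong (3 *_) (S-cong m normalised) ⟩
  3 * S m (λ v → if isNorm v then b2n (R v) else 0)  ≡⟨ cong (3 *_) (sym (numPts-as-sum R)) ⟩
  3 * numPts R                                       ∎)
  where
  open ≡-Reasoning
  removed : V m → ℕ
  removed w = b2n (R (norm w))
  F′ : V m → ℕ
  F′ v = removed (from A v)
  H : V m → ℕ
  H w = if isZ w then 0 else removed w
  removed-invariant : ∀ c v → c ≢ 𝟘 → removed (c ·V v) ≡ removed v
  removed-invariant c v nz = cong (λ t → b2n (R t)) (norm-scale c v nz)
  F′-invariant : ∀ c v → c ≢ 𝟘 → F′ (c ·V v) ≡ F′ v
  F′-invariant c v nz = trans (cong removed (homogeneous (from-linear A) c v)) (removed-invariant c (from A v) nz)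
  normalised : ∀ v → (if isNorm v then removed v else 0) ≡ (if isNorm v then b2n (R v) else 0)
  normalised v with isNorm v in eq
  ... | true = cong (λ t → b2n (R t)) (norm-id v (subst T (sym eq) tt))
  ... | false = refl

two-roots : ∀ c c′ x y → c ≢ c′ → x +F (c *F y) ≡ 𝟘 → x +F (c′ *F y) ≡ 𝟘 → x ≡ 𝟘 × y ≡ 𝟘
two-roots c c′ x y c≢c′ root root′ = x0 , y0
  where
  cy≡c′y : c *F y ≡ c′ *F y
  cy≡c′y = trans (sym (sum0 x _ root)) (sum0 x _ root′)
  [c+c′]y0 : (c +F c′) *F y ≡ 𝟘
  [c+c′]y0 = trans (*F-distʳ c c′ y) (trans (cong ((c *F y) +F_) (sym cy≡c′y)) (+F-self (c *F y)))
  y0 : y ≡ 𝟘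
  y0 with mul-zero _ _ [c+c′]y0
  ... | inj₁ c+c′0 = ⊥-elim (c≢c′ (sum0 c c′ c+c′0))
  ... | inj₂ y0 = y0
  x0 : x ≡ 𝟘
  x0 = trans (sum0 x _ root) (trans (cong (c *F_) y0) (*F-zeroʳ c))

not-false⇒true : ∀ (b : Bool) → b ≢ false → b ≡ true
not-false⇒true true _ = refl
not-false⇒true false b≢false = ⊥-elim (b≢false refl)

-- Two legal truncations R₁, R₂ of PG(k,4) agreeing on
-- the hyperplane x₀ = 0 are placed on the two hyperplanes X₀ = 0 (via v ↦ (0,v))
-- and X₁ = 0 (via (a,z) ↦ (a,0,z)) of PG(k+1,4), which meet in the common part.
module Gluing (k : ℕ) (R₁ R₂ : PtSet (suc k)) (legal₁ : Legal R₁) (legal₂ : Legal R₂)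
  (agree : ∀ (z : V k) → T (isNorm z) → R₁ (𝟘 ∷ z) ≡ R₂ (𝟘 ∷ z)) where

  glued : PtSet (suc (suc k))
  glued (𝟘 ∷ v) = R₁ v
  glued (𝟙 ∷ 𝟘 ∷ z) = R₂ (𝟙 ∷ z)
  glued (𝟙 ∷ 𝟙 ∷ z) = false
  glued (𝟙 ∷ ω ∷ z) = false
  glued (𝟙 ∷ ω² ∷ z) = false
  glued (ω ∷ v) = false
  glued (ω² ∷ v) = false

  common : ℕ
  common = S k (λ z → b2n (isNorm z ∧ R₂ (𝟘 ∷ z)))
  off-common : ℕ
  off-common = S k (λ z → b2n (R₂ (𝟙 ∷ z)))

  -- Inclusion–exclusion: sorting the removed points by their first two
  -- coordinates, |glued| = |R₁| + off-common and |R₂| = common + off-common.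
  glued-count : numPts glued + common ≡ numPts R₁ + numPts R₂
  glued-count = begin
    numPts glued + common
      ≡⟨ cong (_+ common) (countS (suc (suc k)) (λ v → isNorm v ∧ glued v)) ⟩
    (r₁ + ((off-common + (S k (λ _ → 0) + (S k (λ _ → 0) + S k (λ _ → 0)))) + (S (suc k) (λ _ → 0) + S (suc k) (λ _ → 0)))) + common
      ≡⟨ cong₂ (λ s t → (r₁ + ((off-common + (t + (t + t))) + (s + s))) + common) (S-zero (suc k)) (S-zero k) ⟩
    (r₁ + ((off-common + 0) + 0)) + common
      ≡⟨ solve 3 (λ a q p → (a :+ ((q :+ con 0) :+ con 0)) :+ p := a :+ (p :+ (q :+ (con 0 :+ con 0)))) refl r₁ off-common common ⟩
    r₁ + (common + (off-common + (0 + 0)))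
      ≡⟨ cong (λ t → r₁ + (common + (off-common + (t + t)))) (sym (S-zero k)) ⟩
    r₁ + (common + (off-common + (S k (λ _ → 0) + S k (λ _ → 0))))
      ≡⟨ sym (cong₂ _+_ (countS (suc k) (λ v → isNorm v ∧ R₁ v)) (countS (suc k) (λ v → isNorm v ∧ R₂ v))) ⟩
    numPts R₁ + numPts R₂ ∎
    where
    open ≡-Reasoning
    r₁ = S (suc k) (λ x → b2n (isNorm x ∧ R₁ x))

  chart₀ : Chart {suc (suc k)} {suc k} tail (𝟘 ∷_) (λ v → coord v 0 ≡ 𝟘)
  chart₀ = record
    { coords-linear = record { additive = λ { (a ∷ x) (b ∷ y) → refl } ; homogeneous = λ { c (a ∷ x) → refl } }
    ; emb-linear = record { additive = λ x y → refl ; homogeneous = λ c x → cong (_∷ (c ·V x)) (sym (*F-zeroʳ c)) }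
    ; emb-coords = λ { (a ∷ x) a0 → cong (_∷ x) (sym a0) }
    ; coords-emb = λ w → refl
    ; emb-in-Sub = λ w → refl
    ; Sub-scale = λ { c (a ∷ x) a0 → trans (cong (c *F_) a0) (*F-zeroʳ c) } }

  agree₀ : ∀ v → T (isNorm v) → coord v 0 ≡ 𝟘 → R₁ (norm (tail v)) ≡ glued v
  agree₀ (.𝟘 ∷ v) hn refl = cong R₁ (norm-id v hn)

  drop₁ : V (suc (suc k)) → V (suc k)
  drop₁ (a ∷ b ∷ z) = a ∷ z
  insert₁ : V (suc k) → V (suc (suc k))
  insert₁ (a ∷ z) = a ∷ 𝟘 ∷ z

  chart₁ : Chart drop₁ insert₁ (λ v → coord v 1 ≡ 𝟘)
  chart₁ = record
    { coords-linear = record { additive = λ { (a ∷ b ∷ x) (a′ ∷ b′ ∷ y) → refl } ; homogeneous = λ { c (a ∷ b ∷ x) → refl } }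
    ; emb-linear = record { additive = λ { (a ∷ x) (b ∷ y) → refl }
                          ; homogeneous = λ { c (a ∷ x) → cong (λ t → (c *F a) ∷ t ∷ (c ·V x)) (sym (*F-zeroʳ c)) } }
    ; emb-coords = λ { (a ∷ b ∷ x) b0 → cong (λ t → a ∷ t ∷ x) (sym b0) }
    ; coords-emb = λ { (a ∷ x) → refl }
    ; emb-in-Sub = λ { (a ∷ x) → refl }
    ; Sub-scale = λ { c (a ∷ b ∷ x) b0 → trans (cong (c *F_) b0) (*F-zeroʳ c) } }

  agree₁ : ∀ v → T (isNorm v) → coord v 1 ≡ 𝟘 → R₂ (norm (drop₁ v)) ≡ glued v
  agree₁ (𝟘 ∷ .𝟘 ∷ z) hn refl = trans (cong R₂ (norm-id (𝟘 ∷ z) hn)) (sym (agree z hn))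
  agree₁ (𝟙 ∷ .𝟘 ∷ z) hn refl = cong R₂ (norm-id (𝟙 ∷ z) tt)

  module On₀ = ChartLegality chart₀ glued R₁ agree₀
  module On₁ = ChartLegality chart₁ glued R₂ agree₁

  removed-on-hyperplanes : ∀ v → T (isNorm v) → glued v ≡ true → (coord v 0 ≡ 𝟘) ⊎ (coord v 1 ≡ 𝟘)
  removed-on-hyperplanes (𝟘 ∷ v) hn r = inj₁ refl
  removed-on-hyperplanes (𝟙 ∷ 𝟘 ∷ z) hn r = inj₂ refl

  module _ (x y : Pt (suc (suc k))) (retains-only : RetainsOnly glued x y) where
    xv = proj₁ x
    yv = proj₁ y
    x≢y = proj₁ retains-only
    only = proj₂ (proj₂ (proj₂ retains-only))

    OnHyperplanes : F4 → Set
    OnHyperplanes c = (coord xv 0 +F (c *F coord yv 0) ≡ 𝟘) ⊎ (coord xv 1 +F (c *F coord yv 1) ≡ 𝟘)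

    -- since, for c ≠ 0, it is a third point of the line, hence removed
    third-point : ∀ c → c ≢ 𝟘 → OnHyperplanes c
    third-point c c≢0 = on-hyperplanes (removed-on-hyperplanes (proj₁ point) (proj₂ point) removed)
      where
      open ThirdPoint x y x≢y c c≢0
      removed : glued (proj₁ point) ≡ true
      removed = not-false⇒true _ λ retained → [ point≢x , point≢y ]′ (only point on-line retained)
      on-hyperplanes : (coord (proj₁ point) 0 ≡ 𝟘) ⊎ (coord (proj₁ point) 1 ≡ 𝟘) → OnHyperplanes c
      on-hyperplanes (inj₁ z0) = inj₁ (vanishes 0 z0)
      on-hyperplanes (inj₂ z1) = inj₂ (vanishes 1 z1)

    -- the whole line lies in one of the hyperplanes, where the legal R₁ or R₂ lives
    line-in-X₀ : coord xv 0 ≡ 𝟘 × coord yv 0 ≡ 𝟘 → ⊥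
    line-in-X₀ (x0 , y0) = On₀.no-retains-only legal₁ x y x0 y0 retains-only

    line-in-X₁ : coord xv 1 ≡ 𝟘 × coord yv 1 ≡ 𝟘 → ⊥
    line-in-X₁ (x1 , y1) = On₁.no-retains-only legal₂ x y x1 y1 retains-only

    -- pigeonhole: two of the three points x + c y (c = 𝟙, ω, ω²) lie on the same hyperplane
    impossible : ⊥
    impossible with third-point 𝟙 (λ ()) | third-point ω (λ ()) | third-point ω² (λ ())
    ... | inj₁ a | inj₁ b | _ = line-in-X₀ (two-roots 𝟙 ω _ _ (λ ()) a b)
    ... | inj₁ a | inj₂ b | inj₁ c = line-in-X₀ (two-roots 𝟙 ω² _ _ (λ ()) a c)
    ... | inj₁ a | inj₂ b | inj₂ c = line-in-X₁ (two-roots ω ω² _ _ (λ ()) b c)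
    ... | inj₂ a | inj₂ b | _ = line-in-X₁ (two-roots 𝟙 ω _ _ (λ ()) a b)
    ... | inj₂ a | inj₁ b | inj₂ c = line-in-X₁ (two-roots 𝟙 ω² _ _ (λ ()) a c)
    ... | inj₂ a | inj₁ b | inj₁ c = line-in-X₀ (two-roots ω ω² _ _ (λ ()) b c)

  glued-legal : Legal glued
  glued-legal = legal-intro glued impossible

module StandardHyperplane (k : ℕ) (h : Fin k → V (suc k)) (independent : Independent h) where
  A : Aut (suc k)
  A = proj₁ (gauss k h independent)

  sends : ∀ t → to A (h t) ≡ e (tailPos (suc k) t)
  sends = proj₂ (proj₂ (gauss k h independent))

  coeffs : V k → Fin k → F4
  coeffs z t = coord (𝟘 ∷ z) (tailPos (suc k) t)

  from-in-H : ∀ (z : V k) → from A (𝟘 ∷ z) ≡ lincomb (coeffs z) h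
  from-in-H z = begin
    from A (𝟘 ∷ z)
      ≡⟨ cong (from A) (span-tail-units k (n≤1+n k) (𝟘 ∷ z) first-zero) ⟩
    from A (lincomb (coeffs z) (λ t → e (tailPos (suc k) t)))
      ≡⟨ linear-lincomb (from A) (from-linear A) (coeffs z) _ ⟩
    lincomb (coeffs z) (λ t → from A (e (tailPos (suc k) t)))
      ≡⟨ lincomb-cong (coeffs z) _ _ (λ t → trans (cong (from A) (sym (sends t))) (from-to A (h t))) ⟩
    lincomb (coeffs z) h ∎
    where
    open ≡-Reasoning
    first-zero : ∀ p → p + k < suc k → coord (𝟘 ∷ z) p ≡ 𝟘
    first-zero zero lt = refl
    first-zero (suc p) lt = ⊥-elim (<-irrefl refl (≤-trans (s≤s (m≤n+m k p)) (≤-pred lt)))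

  to-H-head : ∀ (c : Fin k → F4) → coord (to A (lincomb c h)) 0 ≡ 𝟘
  to-H-head c = trans (cong (λ t → coord t 0) (trans (linear-lincomb (to A) (to-linear A) c h) (lincomb-cong c _ _ sends)))
                      (lincomb-zeros c _ 0 (λ t → coord-e-diff {suc k} (tailPos (suc k) t) 0 (tailPos-≢ 0 (suc k) k t ≤-refl)))

  from-nonzero : ∀ (z : V k) → T (isNorm z) → isZ (from A (𝟘 ∷ z)) ≡ false
  from-nonzero z hn = trans (isZ-aut A (𝟘 ∷ z)) (isNorm⇒nonzero z hn)

module StandardUntouched (k : ℕ) (R : PtSet (suc k)) (h : Fin k → V (suc k))
  (independent : Independent h) (untouched : Untouched R h) where
  open StandardHyperplane k h independent

  untouched₀ : ∀ z → T (isNorm z) → transport A R (𝟘 ∷ z) ≡ false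
  untouched₀ z hn = untouched (normPt _ (from-nonzero z hn)) (InSpan-scale h _ _ (_ , sym (from-in-H z)))

glue-untouched : ∀ k (n₁ n₂ : ℕ) →
  Σ (PtSet (suc k)) (λ R → numPts R ≡ n₁ × Legal R ×
    Σ (Fin k → Vec F4 (suc k)) (λ h → Independent h × Untouched R h)) →
  Σ (PtSet (suc k)) (λ R → numPts R ≡ n₂ × Legal R ×
    Σ (Fin k → Vec F4 (suc k)) (λ h → Independent h × Untouched R h)) →
  Σ (PtSet (suc (suc k))) (λ R → numPts R ≡ n₁ + n₂ × Legal R)
glue-untouched k n₁ n₂ (R₁ , count₁ , legal₁ , h₁ , ind₁ , untouched₁) (R₂ , count₂ , legal₂ , h₂ , ind₂ , untouched₂) =
  glued , count , glued-legal
  where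
  module S₁ = StandardHyperplane k h₁ ind₁
  module S₂ = StandardHyperplane k h₂ ind₂
  module U₁ = StandardUntouched k R₁ h₁ ind₁ untouched₁
  module U₂ = StandardUntouched k R₂ h₂ ind₂ untouched₂
  open Gluing k (transport S₁.A R₁) (transport S₂.A R₂)
              (transport-legal S₁.A R₁ legal₁) (transport-legal S₂.A R₂ legal₂)
              (λ z hn → trans (U₁.untouched₀ z hn) (sym (U₂.untouched₀ z hn)))
  common≡0 : common ≡ 0
  common≡0 = trans (S-cong k none) (S-zero k)
    where
    none : ∀ z → b2n (isNorm z ∧ transport S₂.A R₂ (𝟘 ∷ z)) ≡ 0
    none z = cong b2n (trans (∧-cong-T (isNorm z) (U₂.untouched₀ z)) (∧-zeroʳ (isNorm z)))
  count : numPts glued ≡ n₁ + n₂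
  count = begin
    numPts glued                   ≡⟨ sym (+-identityʳ _) ⟩
    numPts glued + 0               ≡⟨ cong (numPts glued +_) (sym common≡0) ⟩
    numPts glued + common          ≡⟨ glued-count ⟩
    numPts (transport S₁.A R₁) + numPts (transport S₂.A R₂)
      ≡⟨ cong₂ _+_ (trans (transport-numPts S₁.A R₁) count₁) (trans (transport-numPts S₂.A R₂) count₂) ⟩
    n₁ + n₂                        ∎
    where open ≡-Reasoning

isZero : F4 → Bool
isZero 𝟘 = true
isZero 𝟙 = false
isZero ω = false
isZero ω² = false

firstZero : ∀ {m} → ℕ → V m → Bool
firstZero zero z = true
firstZero (suc d) [] = true
firstZero (suc d) (a ∷ z) = isZero a ∧ firstZero d z

firstZero-sound : ∀ {m} d (z : V m) → firstZero d z ≡ true → ∀ p → p < d → coord z p ≡ 𝟘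
firstZero-sound (suc d) [] h p lt = refl
firstZero-sound (suc d) (𝟘 ∷ z) h zero lt = refl
firstZero-sound (suc d) (𝟘 ∷ z) h (suc p) (s≤s lt) = firstZero-sound d z h p lt

firstZero-complete : ∀ {m} d (z : V m) → (∀ p → p < d → coord z p ≡ 𝟘) → firstZero d z ≡ true
firstZero-complete zero z h = refl
firstZero-complete (suc d) [] h = refl
firstZero-complete (suc d) (a ∷ z) h with h 0 (s≤s z≤n)
... | refl = firstZero-complete d z (λ p lt → h (suc p) (s≤s lt))

count-firstZero : ∀ d m → S (d + m) (λ z → b2n (isNorm z ∧ firstZero d z)) ≡ S m (λ z → b2n (isNorm z))
count-firstZero zero m = S-cong m same
  where
  same : ∀ z → b2n (isNorm z ∧ true) ≡ b2n (isNorm z)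
  same z with isNorm z
  ... | true = refl
  ... | false = refl
count-firstZero (suc d) m rewrite count-firstZero d m | S-zero (d + m) = +-identityʳ _

count-firstZero′ : ∀ {n} d m → n ≡ d + m →
                   S n (λ z → b2n (isNorm z ∧ firstZero d z)) ≡ S m (λ z → b2n (isNorm z))
count-firstZero′ d m refl = count-firstZero d m

qnum-suc : ∀ i → qnum (suc i) ≡ qnum i + 4 ^ suc i
qnum-suc zero = refl
qnum-suc (suc i) = trans (cong (λ t → 1 + 4 * t) (qnum-suc i))
  (solve 2 (λ q p → con 1 :+ con 4 :* (q :+ con 4 :* p) := (con 1 :+ con 4 :* q) :+ con 4 :* (con 4 :* p)) refl (qnum i) (4 ^ i))

count-points : ∀ i → S (suc i) (λ z → b2n (isNorm z)) ≡ qnum i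
count-points zero = refl
count-points (suc i) = begin
  S (suc i) (λ z → b2n (isNorm z)) + (S (suc i) (λ _ → 1) + (S (suc i) (λ _ → 0) + S (suc i) (λ _ → 0)))
    ≡⟨ cong₂ _+_ (count-points i) (cong₂ _+_ (S-one (suc i)) (cong₂ _+_ (S-zero (suc i)) (S-zero (suc i)))) ⟩
  qnum i + (4 ^ suc i + 0)   ≡⟨ cong (qnum i +_) (+-identityʳ _) ⟩
  qnum i + 4 ^ suc i         ≡⟨ sym (qnum-suc i) ⟩
  qnum (suc i)               ∎
  where open ≡-Reasoning

-- Standardising a hyperplane H = span h together with a subspace W = span w ⊆ H
-- such that R ∩ H = W: after A (H ↦ {x₀ = 0}) and an automorphism B of the
-- hyperplane sending W to its last i+1 coordinates, the transported truncation
-- meets x₀ = 0 exactly in the points (0, z) with firstZero (k - (i+1)) z.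
module StandardSubspace (k i : ℕ) (R : PtSet (suc k)) (h : Fin k → V (suc k)) (ind-h : Independent h)
  (w : Fin (suc i) → V (suc k)) (ind-w : Independent w) (meets : MeetsExactly R h w) where
  open StandardHyperplane k h ind-h
  open ≡-Reasoning

  w-in-H : ∀ t → InSpan h (w t)
  w-in-H t = InSpan-unnorm h (w t) (proj₂ (proj₂ (meets (normPt (w t) (independent-nonzero w ind-w t)))
               (InSpan-scale w (w t) _ (δ t , lincomb-δ t w))))

  w′ : Fin (suc i) → V k
  w′ t = tail (to A (w t))

  to-w : ∀ t → to A (w t) ≡ 𝟘 ∷ w′ t
  to-w t with to A (w t) | trans (cong (λ x → coord (to A x) 0) (sym (proj₂ (w-in-H t)))) (to-H-head (proj₁ (w-in-H t)))
  ... | a ∷ x | refl = refl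

  to-W : ∀ (c : Fin (suc i) → F4) → to A (lincomb c w) ≡ 𝟘 ∷ lincomb c w′
  to-W c = trans (linear-lincomb (to A) (to-linear A) c w) (trans (lincomb-cong c _ _ to-w) (lincomb-cons0 c w′))

  ind-w′ : Independent w′
  ind-w′ c eq = ind-w c (to-injective A _ _
    (trans (to-W c) (trans (cong (𝟘 ∷_) eq) (sym (linear-zero (to A) (to-linear A))))))

  B : Aut k
  B = proj₁ (gauss (suc i) w′ ind-w′)
  i<k : suc i ≤ k
  i<k = proj₁ (proj₂ (gauss (suc i) w′ ind-w′))
  B-sends : ∀ t → to B (w′ t) ≡ e (tailPos k t)
  B-sends = proj₂ (proj₂ (gauss (suc i) w′ ind-w′))

  C : Aut (suc k)
  C = liftAut B ∘A A

  d : ℕ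
  d = k ∸ suc i

  C-nonzero : ∀ z → T (isNorm z) → isZ (from C (𝟘 ∷ z)) ≡ false
  C-nonzero z hn = trans (isZ-aut C (𝟘 ∷ z)) (isNorm⇒nonzero z hn)

  standard-W-removed : ∀ z → T (isNorm z) → firstZero d z ≡ true → transport C R (𝟘 ∷ z) ≡ true
  standard-W-removed z hn fz = proj₁ (proj₂ (meets (normPt x (C-nonzero z hn))) (InSpan-scale w x _ (c , sym x≡)))
    where
    x = from C (𝟘 ∷ z)
    c : Fin (suc i) → F4
    c t = coord z (tailPos k t)
    x≡ : x ≡ lincomb c w
    x≡ = begin
      from A (𝟘 ∷ from B z)
        ≡⟨ cong (λ t → from A (𝟘 ∷ from B t)) (span-tail-units (suc i) i<k z
             (λ p lt → firstZero-sound d z fz p (m+n≤o⇒m≤o∸n (suc p) lt))) ⟩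
      from A (𝟘 ∷ from B (lincomb c (λ t → e (tailPos k t))))
        ≡⟨ cong (λ t → from A (𝟘 ∷ t)) (linear-lincomb (from B) (from-linear B) c (λ t → e {k} (tailPos k t))) ⟩
      from A (𝟘 ∷ lincomb c (λ t → from B (e (tailPos k t))))
        ≡⟨ cong (λ t → from A (𝟘 ∷ t)) (lincomb-cong c _ _ (λ t → trans (cong (from B) (sym (B-sends t))) (from-to B (w′ t)))) ⟩
      from A (𝟘 ∷ lincomb c w′)   ≡⟨ cong (from A) (sym (to-W c)) ⟩
      from A (to A (lincomb c w)) ≡⟨ from-to A _ ⟩
      lincomb c w                 ∎

  removed-in-standard-W : ∀ z → T (isNorm z) → transport C R (𝟘 ∷ z) ≡ true → firstZero d z ≡ true
  removed-in-standard-W z hn removed =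
    firstZero-complete d z (λ p lt → trans (cong (λ t → coord t p) z≡)
      (lincomb-zeros c (λ t → e {k} (tailPos k t)) p
        (λ t → coord-e-diff {k} (tailPos k t) p (tailPos-≢ p k (suc i) t (m≤o∸n⇒m+n≤o (suc p) i<k lt)))))
    where
    y = from B z
    x = from A (𝟘 ∷ y)
    in-W : InSpan w x
    in-W = InSpan-unnorm w x (proj₁ (meets (normPt x (C-nonzero z hn)))
             (removed , InSpan-scale h _ _ (_ , sym (from-in-H y))))
    c = proj₁ in-W
    y≡ : y ≡ lincomb c w′
    y≡ = cong tail (begin
      𝟘 ∷ y                 ≡⟨ sym (to-from A _) ⟩
      to A x                ≡⟨ cong (to A) (sym (proj₂ in-W)) ⟩
      to A (lincomb c w)    ≡⟨ to-W c ⟩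
      𝟘 ∷ lincomb c w′      ∎)
    z≡ : z ≡ lincomb c (λ t → e (tailPos k t))
    z≡ = begin
      z                                 ≡⟨ sym (to-from B z) ⟩
      to B y                            ≡⟨ cong (to B) y≡ ⟩
      to B (lincomb c w′)               ≡⟨ linear-lincomb (to B) (to-linear B) c w′ ⟩
      lincomb c (λ t → to B (w′ t))     ≡⟨ lincomb-cong c _ _ B-sends ⟩
      lincomb c (λ t → e (tailPos k t)) ∎

  standard-meet : ∀ z → T (isNorm z) → transport C R (𝟘 ∷ z) ≡ firstZero d z
  standard-meet z hn = true-together (removed-in-standard-W z hn) (standard-W-removed z hn)

  common-size : S k (λ z → b2n (isNorm z ∧ transport C R (𝟘 ∷ z))) ≡ qnum i
  common-size = begin
    S k (λ z → b2n (isNorm z ∧ transport C R (𝟘 ∷ z)))  ≡⟨ S-cong k same ⟩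
    S k (λ z → b2n (isNorm z ∧ firstZero d z))         ≡⟨ count-firstZero′ d (suc i) (sym (m∸n+n≡m i<k)) ⟩
    S (suc i) (λ z → b2n (isNorm z))                  ≡⟨ count-points i ⟩
    qnum i                                            ∎
    where
    same : ∀ z → b2n (isNorm z ∧ transport C R (𝟘 ∷ z)) ≡ b2n (isNorm z ∧ firstZero d z)
    same z = cong b2n (∧-cong-T (isNorm z) (standard-meet z))

glue-meeting : ∀ k (n₁ n₂ i : ℕ) →
  Σ (PtSet (suc k)) (λ R → numPts R ≡ n₁ × Legal R ×
    Σ (Fin k → Vec F4 (suc k)) (λ h → Independent h ×
      Σ (Fin (suc i) → Vec F4 (suc k)) (λ w → Independent w × MeetsExactly R h w))) →
  Σ (PtSet (suc k)) (λ R → numPts R ≡ n₂ × Legal R ×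
    Σ (Fin k → Vec F4 (suc k)) (λ h → Independent h ×
      Σ (Fin (suc i) → Vec F4 (suc k)) (λ w → Independent w × MeetsExactly R h w))) →
  Σ (PtSet (suc (suc k))) (λ R → numPts R ≡ n₁ + n₂ ∸ qnum i × Legal R)
glue-meeting k n₁ n₂ i (R₁ , count₁ , legal₁ , h₁ , ind-h₁ , w₁ , ind-w₁ , meets₁)
                       (R₂ , count₂ , legal₂ , h₂ , ind-h₂ , w₂ , ind-w₂ , meets₂) =
  glued , count , glued-legal
  where
  module S₁ = StandardSubspace k i R₁ h₁ ind-h₁ w₁ ind-w₁ meets₁
  module S₂ = StandardSubspace k i R₂ h₂ ind-h₂ w₂ ind-w₂ meets₂
  open Gluing k (transport S₁.C R₁) (transport S₂.C R₂)
              (transport-legal S₁.C R₁ legal₁) (transport-legal S₂.C R₂ legal₂)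
              (λ z hn → trans (S₁.standard-meet z hn) (sym (S₂.standard-meet z hn)))
  count : numPts glued ≡ n₁ + n₂ ∸ qnum i
  count = begin
    numPts glued                        ≡⟨ sym (m+n∸n≡m (numPts glued) (qnum i)) ⟩
    numPts glued + qnum i ∸ qnum i      ≡⟨ cong (λ t → numPts glued + t ∸ qnum i) (sym S₂.common-size) ⟩
    numPts glued + common ∸ qnum i      ≡⟨ cong (_∸ qnum i) glued-count ⟩
    numPts (transport S₁.C R₁) + numPts (transport S₂.C R₂) ∸ qnum i
      ≡⟨ cong (_∸ qnum i) (cong₂ _+_ (trans (transport-numPts S₁.C R₁) count₁) (trans (transport-numPts S₂.C R₂) count₂)) ⟩
    n₁ + n₂ ∸ qnum i                    ∎
    where open ≡-Reasoning

-- Lemma 4.1, with d = k + 1.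
lemma4p1 : ∀ (k : ℕ) → 1 ≤ k →
  (∀ (n₁ n₂ : ℕ) →
    Σ (PtSet (suc k)) (λ R → numPts R ≡ n₁ × Legal R ×
      Σ (Fin k → Vec F4 (suc k)) (λ h → Independent h × Untouched R h)) →
    Σ (PtSet (suc k)) (λ R → numPts R ≡ n₂ × Legal R ×
      Σ (Fin k → Vec F4 (suc k)) (λ h → Independent h × Untouched R h)) →
    Σ (PtSet (suc (suc k))) (λ R → numPts R ≡ n₁ + n₂ × Legal R))
  ×
  (∀ (n₁ n₂ i : ℕ) →
    Σ (PtSet (suc k)) (λ R → numPts R ≡ n₁ × Legal R ×
      Σ (Fin k → Vec F4 (suc k)) (λ h → Independent h ×
        Σ (Fin (suc i) → Vec F4 (suc k)) (λ w → Independent w × MeetsExactly R h w))) →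
    Σ (PtSet (suc k)) (λ R → numPts R ≡ n₂ × Legal R ×
      Σ (Fin k → Vec F4 (suc k)) (λ h → Independent h ×
        Σ (Fin (suc i) → Vec F4 (suc k)) (λ w → Independent w × MeetsExactly R h w))) →
    Σ (PtSet (suc (suc k))) (λ R → numPts R ≡ n₁ + n₂ ∸ qnum i × Legal R))
lemma4p1 k _ = glue-untouched k , glue-meeting k
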